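{- Let $k,g$ be positive integers and let $H=(V,E=B\sqcup R)$ be a $(k,g)$-counted bi-colored multigraph with $V=\{1,\dots,n\}$. Then the pure condition satisfies $$C_H(\mathbf x)=\sum_{\phi}\pm[\phi_2]\cdots[\phi_n],$$ where the sum runs over all distinct $(k,g)$-fans $\phi=(\phi_2,\dots,\phi_n)$ of $H$ (one representative per distinct fan), and each term carries a sign $\pm 1$.
   Context: A bi-colored graph is a multigraph $H=(V,E=B\sqcup R)$ with $V=\{1,\dots,n\}$, $m=|E|$ edges, of which $m_B=|B|$ are black and $m_R=|R|$ are red. $H$ is $(k,g)$-counted if $m=kn-k$ and $m_R\le gn-g$. The generic $(k,g)$-frame $H(\mathbf x)$ assigns to each edge $e$ a vector $\mathbf x(e)\in$ (polynomial ring)$^k$: for $b\in B$, $\mathbf x(b)_j$ ($j=1,\dots,k$) are indeterminates; for $r\in R$, $\mathbf x(r)_j=0$ for $j=1,\dots,k-g$ and $\mathbf x(r)_j$ ($j=k-g+1,\dots,k$) are indeterminates; all these indeterminates are algebraically independent. The rigidity matrix $M(H(\mathbf x))$ has $k$ columns per vertex and one row per edge $e=uv$ ($u<v$), with $\mathbf x(e)$ in the $k$ columns of $u$, $-\mathbf x(e)$ in the $k$ columns of $v$, and $0$ elsewhere. $M_T(H(\mathbf x))$ is the square matrix obtained by appending below $M(H(\mathbf x))$ the $k\times kn$ matrix with the $k\times k$ identity in the first $k$ columns and zeros elsewhere. The pure condition is $C_H(\mathbf x)=\det M_T(H(\mathbf x))$. A $(k,g)$-fan of $H$ is a partition of $E$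 into $n-1$ ordered sets $(\phi_2,\dots,\phi_n)$ such that each $\phi_i=(\phi_{i,1},\dots,\phi_{i,k})$ consists of exactly $k$ edges incident to vertex $i$ and contains at most $g$ red edges. $[\phi_i]$ denotes the determinant of the $k\times k$ matrix with rows $\mathbf x(\phi_{i,1}),\dots,\mathbf x(\phi_{i,k})$. Two $(k,g)$-fans $\phi,\phi'$ are distinct if there is a vertex $i$ with $\phi_i\neq\phi'_i$ as unordered sets. -}

module Defs where

open import Level using (0ℓ)
open import Data.Bool using (Bool; true; false; T; if_then_else_)
open import Data.Nat as ℕ using (ℕ; zero; suc; _∸_; _≤_; s≤s; z≤n)
import Data.Nat.Properties as ℕP
open import Data.Fin as F using (Fin; zero; suc; toℕ; splitAt; remQuot; cast; punchIn)
open import Data.Fin.Properties using (all?)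
open import Data.List using (List; []; _∷_; map; filter; length; concatMap; foldr; allFin)
open import Data.Product using (_×_; _,_)
open import Data.Sum using (_⊎_; inj₁; inj₂)
open import Relation.Nullary using (Dec; yes; no; ¬_; ¬?)
open import Relation.Nullary.Decidable using (_×-dec_; _⊎-dec_; _→-dec_; T?)
open import Relation.Binary.PropositionalEquality using (_≡_; _≢_; refl; sym; trans; cong)
open import Algebra.Bundles using (CommutativeRing)

-- Bi-colored multigraphs on the vertex set Fin n (vertex "1" of the
-- paper is Fin.zero, vertex i is the Fin element with toℕ = i - 1),
-- with m edges indexed by Fin m.  Edge e = uv has endpoints
-- src e < tgt e (so u < v as in the rigidity-matrix convention);
-- red e = true means e ∈ R, red e = false means e ∈ B.

record BiGraph (n m : ℕ) : Set where
  field
    src     : Fin m → Fin n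
    tgt     : Fin m → Fin n
    ordered : ∀ e → src e F.< tgt e
    red     : Fin m → Bool
open BiGraph public

redCount : ∀ {n m} → BiGraph n m → ℕ
redCount {m = m} H = length (filter (λ e → T? (red H e)) (allFin m))

record Counted (k g : ℕ) {n m : ℕ} (H : BiGraph n m) : Set where
  field
    edgeCount : m ≡ k ℕ.* n ∸ k
    redBound  : redCount H ≤ g ℕ.* n ∸ g
open Counted public

-- For n ≥ 1, the counting condition makes M_T square: kn = m + k.
counted⇒square : ∀ {k g n m} {H : BiGraph n m} → 1 ≤ n → Counted k g H →
                 n ℕ.* k ≡ m ℕ.+ k
counted⇒square {k} {g} {suc n'} {m} {H} (s≤s z≤n) c =
  trans (ℕP.*-comm (suc n') k)
    (sym (trans (cong (ℕ._+ k) (edgeCount c))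
                (ℕP.m∸n+n≡m (ℕP.m≤m*n k (suc n')))))

-- Fans, encoded by their "owner" map.  A (k,g)-fan is a partition of E
-- into parts φ_2,…,φ_n; as unordered sets it is exactly a map
-- o : E → V with o e ≠ vertex 1, where φ_i = o⁻¹(i).

edgesOf : ∀ {n m} → (Fin m → Fin n) → Fin n → List (Fin m)
edgesOf {n} {m} o i = filter (λ e → o e F.≟ i) (allFin m)

redEdgesOf : ∀ {n m} → BiGraph n m → (Fin m → Fin n) → Fin n → List (Fin m)
redEdgesOf H o i = filter (λ e → T? (red H e)) (edgesOf o i)

IsFan : ∀ (k g : ℕ) {n m} → BiGraph n m → (Fin m → Fin n) → Set
IsFan k g {n} {m} H o =
  (∀ (e : Fin m) → (toℕ (o e) ≢ 0) × (o e ≡ src H e ⊎ o e ≡ tgt H e)) ×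
  (∀ (i : Fin n) → toℕ i ≢ 0 →
     (length (edgesOf o i) ≡ k) × (length (redEdgesOf H o i) ≤ g))

isFan? : ∀ (k g : ℕ) {n m} (H : BiGraph n m) → (o : Fin m → Fin n) → Dec (IsFan k g H o)
isFan? k g H o =
  all? (λ e → ¬? (toℕ (o e) ℕ.≟ 0) ×-dec ((o e F.≟ src H e) ⊎-dec (o e F.≟ tgt H e))) ×-dec
  all? (λ i → ¬? (toℕ i ℕ.≟ 0) →-dec
                ((length (edgesOf o i) ℕ.≟ k) ×-dec (length (redEdgesOf H o i) ℕ.≤? g)))

consF : ∀ {m n} → Fin n → (Fin m → Fin n) → Fin (suc m) → Fin n
consF i f zero    = i
consF i f (suc e) = f e

allFuns : ∀ m n → List (Fin m → Fin n)
allFuns zero    n = (λ ()) ∷ []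
allFuns (suc m) n = concatMap (λ f → map (λ i → consF i f) (allFin n)) (allFuns m n)

module Frame (Rg : CommutativeRing 0ℓ 0ℓ) where
  open CommutativeRing Rg using (Carrier; _≈_; _+_; _*_; -_; 0#; 1#)

  sumFin : ∀ N → (Fin N → Carrier) → Carrier
  sumFin zero    f = 0#
  sumFin (suc N) f = f zero + sumFin N (λ i → f (suc i))

  prodFin : ∀ N → (Fin N → Carrier) → Carrier
  prodFin zero    f = 1#
  prodFin (suc N) f = f zero * prodFin N (λ i → f (suc i))

  alt : ℕ → Carrier → Carrier
  alt zero    a = a
  alt (suc i) a = - alt i a

  det : ∀ {N} → (Fin N → Fin N → Carrier) → Carrier
  det {zero}  A = 1#
  det {suc N} A =
    sumFin (suc N) (λ j → alt (toℕ j) (A zero j * det (λ r c → A (suc r) (punchIn j c))))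

  -- A (k,g)-frame on H over Rg: a vector x(e) ∈ Rg^k per edge, with the
  -- first k-g coordinates of every red edge equal to 0.  (Specialisation
  -- of the generic frame.)
  record Frame (k g : ℕ) {n m : ℕ} (H : BiGraph n m) : Set where
    field
      vec     : Fin m → Fin k → Carrier
      redZero : ∀ e → T (red H e) → ∀ (j : Fin k) → toℕ j ℕ.< k ∸ g → vec e j ≈ 0#
  open Frame public

  -- rigidity matrix entry: row e = uv, column (vertex w, coordinate j);
  -- columns are ordered vertex-major (k columns per vertex).
  rigEntry : ∀ {k g n m} {H : BiGraph n m} → Frame k g H → Fin m → Fin n → Fin k → Carrier
  rigEntry {H = H} x e w j with w F.≟ src H e | w F.≟ tgt H e
  ... | yes _ | _         = vec x e j
  ... | no _  | yes _ = - vec x e j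
  ... | no _  | no _  = 0#

  -- M_T(H(x)) : rigidity matrix with [I_k 0 … 0] appended below
  MT : ∀ {k g n m} {H : BiGraph n m} → Frame k g H →
       Fin (m ℕ.+ k) → Fin (n ℕ.* k) → Carrier
  MT {k} {g} {n} {m} x r c with splitAt m r | remQuot {n} k c
  ... | inj₁ e | (w , j) = rigEntry x e w j
  ... | inj₂ t | (w , j) with toℕ w ℕ.≟ 0 | j F.≟ t
  ...   | yes _ | yes _ = 1#
  ...   | _         | _         = 0#

  pureCondition : ∀ {k g n m} {H : BiGraph n m} → Frame k g H →
                  .(n ℕ.* k ≡ m ℕ.+ k) → Carrier
  pureCondition {k} {g} {n} x sq = det {n ℕ.* k} (λ r c → MT x (cast sq r) c)

  -- k×k matrix whose rows are the given list of vectors (0 rows if short)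
  rowsMatrix : ∀ {k} → List (Fin k → Carrier) → Fin k → Fin k → Carrier
  rowsMatrix []      r       = λ _ → 0#
  rowsMatrix (v ∷ l) zero    = v
  rowsMatrix (v ∷ l) (suc r) = rowsMatrix l (F.inject₁ r)

  -- [φ_i] : det of the rows x(e), e ∈ φ_i listed in increasing edge order
  bracket : ∀ {k g n m} {H : BiGraph n m} → Frame k g H → (Fin m → Fin n) → Fin n → Carrier
  bracket {k} x o i = det {k} (rowsMatrix (map (vec x) (edgesOf o i)))

  fanProduct : ∀ {k g n m} {H : BiGraph n m} → Frame k g H → (Fin m → Fin n) → Carrier
  fanProduct {n = n} x o = prodFin n factor
    where
      factor : Fin n → Carrier
      factor zero    = 1#
      factor (suc i) = bracket x o (suc i)

  sgn : Bool → Carrier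
  sgn true  = 1#
  sgn false = - 1#

  fanSum : ∀ {k g n m} {H : BiGraph n m} → ((Fin m → Fin n) → Bool) → Frame k g H → Carrier
  fanSum {k} {g} {n} {m} {H} σ x =
    foldr _+_ 0# (map (λ o → sgn (σ o) * fanProduct x o) (filter (isFan? k g H) (allFuns m n)))

module Submission where

-- Expand det M_T by multilinearity in the m edge rows: splitting the row of e into its parts in
-- the k columns of each vertex gives det M_T = Σ_o det M_o over all maps o : E → V, where M_o
-- keeps row e only in the columns of o e.  The row vanishes unless o e is an endpoint of e.
-- Otherwise M_o is block diagonal: vertex w owns the rows o⁻¹(w) (vertex 1 also the k rows of
-- the identity) and its own k columns.  Such a determinant is 0 unless all blocks are square,
-- and then it is ± the product of the blocks.  Square blocks mean o⁻¹(1) = ∅ and |o⁻¹(i)| = k;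
-- the block of vertex 1 is the identity and that of i ≥ 2 is ±[φ_i], its rows being ±x(e).
-- It vanishes when φ_i has more than g red edges, as red rows are 0 on the first k - g columns.
-- The surviving o are exactly the (k,g)-fans, and the sign depends on o alone.


open import Defs
open import Level using (0ℓ)
open import Algebra.Bundles using (CommutativeRing)
open import Function using (_∘_; id; _⇔_; mk⇔; Equivalence)
open import Data.Bool using (Bool; true; false; if_then_else_; not)
open import Data.Bool.Properties using (T-≡)
open import Data.Nat as ℕ using (ℕ; zero; suc; _≤_; z≤n; s≤s)
import Data.Nat.Properties as ℕP
open import Data.Fin as F using (Fin; zero; suc; toℕ; punchIn; _≟_)
import Data.Fin.Properties as FP
open import Data.Product using (_×_; _,_; proj₁; proj₂; Σ-syntax)
open import Data.Sum using (_⊎_; inj₁; inj₂; [_,_]′)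
open import Data.Unit using (⊤; tt)
open import Data.List
  using (List; []; _∷_; map; length; filter; allFin; tabulate; lookup; removeAt; _++_; foldr; concatMap)
import Data.List.Properties as LP
open import Data.List.Relation.Unary.All as All using (All; []; _∷_)
open import Data.List.Relation.Unary.All.Properties using (all-filter)
open import Data.List.Relation.Unary.Unique.Propositional using (Unique)
import Data.List.Relation.Unary.Unique.Propositional.Properties as Unique
open import Data.List.Relation.Unary.AllPairs using (_∷_)
open import Data.List.Membership.Propositional using (_∈_)
open import Data.List.Membership.Propositional.Properties using (∈-lookup; ∈-filter⁺; ∈-allFin)
open import Data.List.Relation.Unary.Any using (here; there)
open import Relation.Nullary using (Dec; yes; no; does; ¬_; ¬?; contradiction; _⊎-dec_)
open import Relation.Nullary.Decidable using (dec-true; dec-false; T?)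
open import Relation.Unary using (Pred; Decidable)
open import Relation.Binary using (_Preserves_⟶_; Tri; tri<; tri≈; tri>)
open import Relation.Binary.PropositionalEquality
  using (_≡_; _≢_; refl; sym; trans; cong; cong₂; subst; module ≡-Reasoning)
import Algebra.Properties.CommutativeMonoid.Sum ℕP.+-0-commutativeMonoid as ℕΣ

𝟙 : Bool → ℕ
𝟙 b = if b then 1 else 0

even : ℕ → Bool
even zero    = true
even (suc e) = not (even e)

count : ∀ {K} → (Fin K → Bool) → ℕ
count p = ℕΣ.sum (𝟙 ∘ p)

m∸[m∸n]≤n : ∀ m n → m ℕ.∸ (m ℕ.∸ n) ≤ n
m∸[m∸n]≤n m n with ℕP.≤-total n m
... | inj₁ n≤m = ℕP.≤-reflexive (ℕP.m∸[m∸n]≡n n≤m)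
... | inj₂ m≤n = subst (λ d → m ℕ.∸ d ≤ n) (sym (ℕP.m≤n⇒m∸n≡0 m≤n)) m≤n

∑-zero : ∀ K {f : Fin K → ℕ} → (∀ i → f i ≡ 0) → ℕΣ.sum f ≡ 0
∑-zero K f≡0 = trans (ℕΣ.sum-cong-≗ f≡0) (ℕΣ.sum-replicate-zero K)

∑-indicator : ∀ {n} (a : Fin n) (f : Fin n → ℕ) → ℕΣ.sum (λ w → f w ℕ.* 𝟙 (does (a ≟ w))) ≡ f a
∑-indicator {suc n} zero f =
  trans (cong₂ ℕ._+_ (ℕP.*-identityʳ (f zero)) (∑-zero n (λ w → ℕP.*-zeroʳ (f (suc w)))))
        (ℕP.+-identityʳ (f zero))
∑-indicator {suc n} (suc a) f =
  trans (cong (ℕ._+ ℕΣ.sum (λ w → f (suc w) ℕ.* 𝟙 (does (a ≟ w)))) (ℕP.*-zeroʳ (f zero)))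
        (∑-indicator a (f ∘ suc))

filter-map : ∀ {A B : Set} {P : Pred B 0ℓ} (P? : Decidable P) (g : A → B) xs →
  filter P? (map g xs) ≡ map g (filter (P? ∘ g) xs)
filter-map P? g [] = refl
filter-map P? g (x ∷ xs) with does (P? (g x))
... | true  = cong (g x ∷_) (filter-map P? g xs)
... | false = filter-map P? g xs

filter-comm : ∀ {A : Set} {P Q : Pred A 0ℓ} (P? : Decidable P) (Q? : Decidable Q) xs →
  filter P? (filter Q? xs) ≡ filter Q? (filter P? xs)
filter-comm P? Q? [] = refl
filter-comm P? Q? (x ∷ xs) with does (P? x) in p | does (Q? x) in q
... | true  | true  rewrite p | q = cong (x ∷_) (filter-comm P? Q? xs)
... | true  | false rewrite q     = filter-comm P? Q? xs
... | false | true  rewrite p     = filter-comm P? Q? xs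
... | false | false               = filter-comm P? Q? xs

filter-tabulate-suc : ∀ {N} {P : Pred (Fin (suc N)) 0ℓ} (P? : Decidable P) →
  filter P? (tabulate suc) ≡ map suc (filter (P? ∘ suc) (allFin N))
filter-tabulate-suc {N} P? =
  trans (cong (filter P?) (sym (LP.map-tabulate id suc))) (filter-map P? suc (allFin N))

filter-allFin-suc : ∀ {N} {P : Pred (Fin (suc N)) 0ℓ} (P? : Decidable P) →
  filter P? (allFin (suc N)) ≡ (if does (P? zero) then zero ∷ map suc (filter (P? ∘ suc) (allFin N))
                                                 else map suc (filter (P? ∘ suc) (allFin N)))
filter-allFin-suc P? with does (P? zero)
... | true  = cong (zero ∷_) (filter-tabulate-suc P?)
... | false = filter-tabulate-suc P?

allFin-+ : ∀ a b → allFin (a ℕ.+ b) ≡ map (F._↑ˡ b) (allFin a) ++ map (a F.↑ʳ_) (allFin b)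
allFin-+ zero    b = sym (LP.map-id (allFin b))
allFin-+ (suc a) b = cong (zero ∷_) (begin
  tabulate suc                                                      ≡⟨ sym (LP.map-tabulate id suc) ⟩
  map suc (allFin (a ℕ.+ b))                                        ≡⟨ cong (map suc) (allFin-+ a b) ⟩
  map suc (map (F._↑ˡ b) (allFin a) ++ map (a F.↑ʳ_) (allFin b))   ≡⟨ LP.map-++ suc (map (F._↑ˡ b) (allFin a)) _ ⟩
  map suc (map (F._↑ˡ b) (allFin a)) ++ map suc (map (a F.↑ʳ_) (allFin b))
    ≡⟨ cong₂ _++_ (trans (sym (LP.map-∘ (allFin a))) (trans (LP.map-tabulate id (λ i → suc i F.↑ˡ b))
                         (sym (LP.map-tabulate suc (F._↑ˡ b)))))
                  (sym (LP.map-∘ (allFin b))) ⟩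
  map (F._↑ˡ b) (tabulate suc) ++ map (suc a F.↑ʳ_) (allFin b) ∎)
  where open ≡-Reasoning

filter-≢-removeAt : ∀ {N} {l : List (Fin N)} → Unique l → (t : Fin (length l)) →
  filter (λ c → ¬? (c ≟ lookup l t)) l ≡ removeAt l t
filter-≢-removeAt {l = x ∷ l} (x∉l ∷ u) zero =
  trans (LP.filter-reject (λ c → ¬? (c ≟ x)) (λ x≢x → x≢x refl))
        (LP.filter-all (λ c → ¬? (c ≟ x)) (All.map (λ x≢c c≡x → x≢c (sym c≡x)) x∉l))
filter-≢-removeAt {l = x ∷ l} (x∉l ∷ u) (suc t) =
  trans (LP.filter-accept (λ c → ¬? (c ≟ lookup l t)) (All.lookup x∉l (∈-lookup t)))
        (cong (x ∷_) (filter-≢-removeAt u t))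

at : ∀ {X A : Set} → A → (X → A) → List X → ℕ → A
at d f []       i       = d
at d f (x ∷ xs) zero    = f x
at d f (x ∷ xs) (suc i) = at d f xs i

at-cong : ∀ {X A : Set} (d : A) {f g : X → A} (xs : List X) → (∀ x → f x ≡ g x) →
  ∀ i → at d f xs i ≡ at d g xs i
at-cong d []       f≡g i       = refl
at-cong d (x ∷ xs) f≡g zero    = f≡g x
at-cong d (x ∷ xs) f≡g (suc i) = at-cong d xs f≡g i

at-map : ∀ {X Y A : Set} (d : A) (f : Y → A) (g : X → Y) xs i → at d f (map g xs) i ≡ at d (f ∘ g) xs i
at-map d f g []       i       = refl
at-map d f g (x ∷ xs) zero    = refl
at-map d f g (x ∷ xs) (suc i) = at-map d f g xs i

at-lookup : ∀ {X A : Set} (d : A) (f : X → A) xs (t : Fin (length xs)) → at d f xs (toℕ t) ≡ f (lookup xs t)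
at-lookup d f (x ∷ xs) zero    = refl
at-lookup d f (x ∷ xs) (suc t) = at-lookup d f xs t

at-removeAt : ∀ {X A : Set} (d : A) (f : X → A) (x : X) xs (t : Fin (suc (length xs))) (c : Fin (length xs)) →
  at d f (x ∷ xs) (toℕ (punchIn t c)) ≡ at d f (removeAt (x ∷ xs) t) (toℕ c)
at-removeAt d f x xs       zero    c       = refl
at-removeAt d f x (y ∷ xs) (suc t) zero    = refl
at-removeAt d f x (y ∷ xs) (suc t) (suc c) = at-removeAt d f y xs t c

at-tabulate : ∀ {X A : Set} (d : A) (f : X → A) {K} (g : Fin K → X) (i : Fin K) →
  at d f (tabulate g) (toℕ i) ≡ f (g i)
at-tabulate d f g zero    = refl
at-tabulate d f g (suc i) = at-tabulate d f (g ∘ suc) i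

count-at : ∀ {X : Set} (p : X → Bool) xs →
  count {length xs} (λ i → at false p xs (toℕ i)) ≡ length (filter (T? ∘ p) xs)
count-at p []       = refl
count-at p (x ∷ xs) with p x
... | true  = cong suc (count-at p xs)
... | false = count-at p xs

-- Fibres of maps between finite sets

-- Defs.edgesOf is fibre by definition.
fibre : ∀ {N n} → (Fin N → Fin n) → Fin n → List (Fin N)
fibre f w = filter (λ r → f r ≟ w) (allFin _)

fibreSize : ∀ {N n} → (Fin N → Fin n) → Fin n → ℕ
fibreSize f w = length (fibre f w)

fibre-unique : ∀ {N n} (f : Fin N → Fin n) w → Unique (fibre f w)
fibre-unique {N} f w = Unique.filter⁺ (λ r → f r ≟ w) (Unique.allFin⁺ N)

fibre-lookup : ∀ {N n} (f : Fin N → Fin n) w (t : Fin (fibreSize f w)) → f (lookup (fibre f w) t) ≡ w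
fibre-lookup f w t = All.lookup (all-filter (λ r → f r ≟ w) (allFin _)) (∈-lookup t)

fibre-cong : ∀ {N n} {f g : Fin N → Fin n} → (∀ r → f r ≡ g r) → ∀ w → fibre f w ≡ fibre g w
fibre-cong {f = f} {g} f≗g w =
  LP.filter-≐ (λ r → f r ≟ w) (λ r → g r ≟ w) (trans (sym (f≗g _)) , trans (f≗g _)) (allFin _)

fibre-const : ∀ {N n} (a w : Fin n) → fibre {N} (λ _ → a) w ≡ (if does (a ≟ w) then allFin N else [])
fibre-const a w with a ≟ w
... | yes a≡w = LP.filter-all (λ _ → yes a≡w) (All.universal (λ _ → a≡w) (allFin _))
... | no  a≢w = LP.filter-none (λ _ → no a≢w) (All.universal (λ _ → a≢w) (allFin _))

fibre-suc∘ : ∀ {N n} (f : Fin N → Fin n) w → fibre (suc ∘ f) (suc w) ≡ fibre f w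
fibre-suc∘ f w =
  LP.filter-≐ (λ r → suc (f r) ≟ suc w) (λ r → f r ≟ w) (FP.suc-injective , cong suc) (allFin _)

fibre-+ : ∀ {a b n} (f : Fin (a ℕ.+ b) → Fin n) w →
  fibre f w ≡ map (F._↑ˡ b) (fibre (f ∘ (F._↑ˡ b)) w) ++ map (a F.↑ʳ_) (fibre (f ∘ (a F.↑ʳ_)) w)
fibre-+ {a} {b} f w = begin
  filter (λ r → f r ≟ w) (allFin (a ℕ.+ b))
    ≡⟨ cong (filter (λ r → f r ≟ w)) (allFin-+ a b) ⟩
  filter (λ r → f r ≟ w) (map (F._↑ˡ b) (allFin a) ++ map (a F.↑ʳ_) (allFin b))
    ≡⟨ LP.filter-++ (λ r → f r ≟ w) (map (F._↑ˡ b) (allFin a)) _ ⟩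
  filter (λ r → f r ≟ w) (map (F._↑ˡ b) (allFin a)) ++ filter (λ r → f r ≟ w) (map (a F.↑ʳ_) (allFin b))
    ≡⟨ cong₂ _++_ (filter-map (λ r → f r ≟ w) (F._↑ˡ b) (allFin a))
                  (filter-map (λ r → f r ≟ w) (a F.↑ʳ_) (allFin b)) ⟩
  map (F._↑ˡ b) (fibre (f ∘ (F._↑ˡ b)) w) ++ map (a F.↑ʳ_) (fibre (f ∘ (a F.↑ʳ_)) w) ∎
  where open ≡-Reasoning

fibre-cast : ∀ {M N n} (p : M ≡ N) (f : Fin M → Fin n) w →
  fibre (f ∘ F.cast (sym p)) w ≡ map (F.cast p) (fibre f w)
fibre-cast refl f w = trans (fibre-cong (cong f ∘ FP.cast-is-id refl) w)
  (sym (trans (LP.map-cong (FP.cast-is-id refl) (fibre f w)) (LP.map-id (fibre f w))))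

fibreSize≡0 : ∀ {N n} (f : Fin N → Fin n) w → fibreSize f w ≡ 0 → ∀ r → f r ≢ w
fibreSize≡0 f w size≡0 r fr≡w = nonempty (∈-filter⁺ (λ r → f r ≟ w) (∈-allFin r) fr≡w) size≡0
  where
  nonempty : ∀ {r rs} → r ∈ rs → length rs ≢ 0
  nonempty (here _)  ()
  nonempty (there _) ()

fibreSize-suc : ∀ {N n} (f : Fin (suc N) → Fin n) w →
  fibreSize f w ≡ 𝟙 (does (f zero ≟ w)) ℕ.+ fibreSize (f ∘ suc) w
fibreSize-suc f w = trans (cong length (filter-allFin-suc (λ r → f r ≟ w))) (lengthIf (does (f zero ≟ w)))
  where
  lengthIf : ∀ b → length (if b then zero ∷ map suc (fibre (f ∘ suc) w) else map suc (fibre (f ∘ suc) w))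
                   ≡ 𝟙 b ℕ.+ fibreSize (f ∘ suc) w
  lengthIf true  = cong suc (LP.length-map suc (fibre (f ∘ suc) w))
  lengthIf false = LP.length-map suc (fibre (f ∘ suc) w)

fibre-suc-≢ : ∀ {N n} (f : Fin (suc N) → Fin n) w → f zero ≢ w → fibre f w ≡ map suc (fibre (f ∘ suc) w)
fibre-suc-≢ f w f₀≢w = trans (filter-allFin-suc (λ r → f r ≟ w))
  (cong (λ b → if b then zero ∷ map suc (fibre (f ∘ suc) w) else map suc (fibre (f ∘ suc) w))
        (dec-false (f zero ≟ w) f₀≢w))

fibre-suc-head : ∀ {N n} (f : Fin (suc N) → Fin n) →
  fibre f (f zero) ≡ zero ∷ map suc (fibre (f ∘ suc) (f zero))
fibre-suc-head f = trans (filter-allFin-suc (λ r → f r ≟ f zero))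
  (cong (λ b → if b then zero ∷ map suc (fibre (f ∘ suc) (f zero)) else map suc (fibre (f ∘ suc) (f zero)))
        (dec-true (f zero ≟ f zero) refl))

-- Deleting a row and a column

Monotone : ∀ {N n} → (Fin N → Fin n) → Set
Monotone f = f Preserves F._≤_ ⟶ F._≤_

monotone-punchIn : ∀ {N n} {f : Fin (suc N) → Fin n} j → Monotone f → Monotone (f ∘ punchIn j)
monotone-punchIn j mono = mono ∘ FP.punchIn-mono-≤ j _ _

toℕ-punchIn-< : ∀ {K} (j : Fin (suc K)) t → toℕ t ℕ.< toℕ j → toℕ (punchIn j t) ≡ toℕ t
toℕ-punchIn-< (suc j) zero    _         = refl
toℕ-punchIn-< (suc j) (suc t) (s≤s t<j) = cong suc (toℕ-punchIn-< j t t<j)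

toℕ-punchIn-≤ : ∀ {K} (j : Fin (suc K)) t → toℕ (punchIn j t) ≤ suc (toℕ t)
toℕ-punchIn-≤ zero    t       = ℕP.≤-refl
toℕ-punchIn-≤ (suc j) zero    = z≤n
toℕ-punchIn-≤ (suc j) (suc t) = s≤s (toℕ-punchIn-≤ j t)

map-punchIn-allFin : ∀ {N} (j : Fin (suc N)) →
  map (punchIn j) (allFin N) ≡ filter (λ c → ¬? (c ≟ j)) (allFin (suc N))
map-punchIn-allFin {N} zero =
  sym (trans (filter-tabulate-suc (λ c → ¬? (c ≟ zero)))
             (cong (map suc) (LP.filter-all _ (All.universal (λ c ()) (allFin N)))))
map-punchIn-allFin {suc N} (suc j) = cong (zero ∷_) (begin
  map (punchIn (suc j)) (tabulate suc)         ≡⟨ LP.map-tabulate suc (punchIn (suc j)) ⟩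
  tabulate (suc ∘ punchIn j)                   ≡⟨ sym (LP.map-tabulate (punchIn j) suc) ⟩
  map suc (tabulate (punchIn j))               ≡⟨ cong (map suc) (sym (LP.map-tabulate id (punchIn j))) ⟩
  map suc (map (punchIn j) (allFin N))         ≡⟨ cong (map suc) (map-punchIn-allFin j) ⟩
  map suc (filter (λ c → ¬? (c ≟ j)) (allFin (suc N)))
    ≡⟨ cong (map suc) (LP.filter-≐ (λ c → ¬? (c ≟ j)) (λ c → ¬? (suc c ≟ suc j))
                                   (sucⁿ , sucᵒ) (allFin (suc N))) ⟩
  map suc (filter (λ c → ¬? (suc c ≟ suc j)) (allFin (suc N)))
    ≡⟨ sym (filter-tabulate-suc (λ c → ¬? (c ≟ suc j))) ⟩
  filter (λ c → ¬? (c ≟ suc j)) (tabulate suc) ∎)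
  where
  open ≡-Reasoning
  sucⁿ : ∀ {c} → c ≢ j → suc c ≢ suc j
  sucⁿ c≢j = c≢j ∘ FP.suc-injective
  sucᵒ : ∀ {c} → suc c ≢ suc j → c ≢ j
  sucᵒ sc≢sj = sc≢sj ∘ cong suc

fibre-punchIn : ∀ {N n} (f : Fin (suc N) → Fin n) j w →
  map (punchIn j) (fibre (f ∘ punchIn j) w) ≡ filter (λ c → ¬? (c ≟ j)) (fibre f w)
fibre-punchIn {N} f j w = begin
  map (punchIn j) (fibre (f ∘ punchIn j) w)
    ≡⟨ sym (filter-map (λ c → f c ≟ w) (punchIn j) (allFin N)) ⟩
  filter (λ c → f c ≟ w) (map (punchIn j) (allFin N))
    ≡⟨ cong (filter (λ c → f c ≟ w)) (map-punchIn-allFin j) ⟩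
  filter (λ c → f c ≟ w) (filter (λ c → ¬? (c ≟ j)) (allFin (suc N)))
    ≡⟨ filter-comm (λ c → f c ≟ w) (λ c → ¬? (c ≟ j)) (allFin (suc N)) ⟩
  filter (λ c → ¬? (c ≟ j)) (fibre f w) ∎
  where open ≡-Reasoning

fibre-punchIn-≢ : ∀ {N n} (f : Fin (suc N) → Fin n) j w → f j ≢ w →
  map (punchIn j) (fibre (f ∘ punchIn j) w) ≡ fibre f w
fibre-punchIn-≢ f j w fj≢w = trans (fibre-punchIn f j w)
  (LP.filter-all _ (All.map (λ { fc≡w refl → fj≢w fc≡w }) (all-filter (λ c → f c ≟ w) (allFin _))))

fibre-punchIn-lookup : ∀ {N n} (f : Fin (suc N) → Fin n) w (t : Fin (fibreSize f w)) →
  map (punchIn (lookup (fibre f w) t)) (fibre (f ∘ punchIn (lookup (fibre f w) t)) w) ≡ removeAt (fibre f w) t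
fibre-punchIn-lookup f w t =
  trans (fibre-punchIn f (lookup (fibre f w) t) w) (filter-≢-removeAt (fibre-unique f w) t)

decrementAt : ∀ {n} → Fin n → (Fin n → ℕ) → Fin n → ℕ
decrementAt b sz w = if does (b ≟ w) then ℕ.pred (sz w) else sz w

fibreSize-punchIn-lookup : ∀ {N n} (f : Fin (suc N) → Fin n) w (t : Fin (fibreSize f w)) v →
  fibreSize (f ∘ punchIn (lookup (fibre f w) t)) v ≡ decrementAt w (fibreSize f) v
fibreSize-punchIn-lookup f w t v with w ≟ v
... | yes refl = begin
  fibreSize (f ∘ punchIn j) w              ≡⟨ sym (LP.length-map (punchIn j) (fibre (f ∘ punchIn j) w)) ⟩
  length (map (punchIn j) (fibre (f ∘ punchIn j) w)) ≡⟨ cong length (fibre-punchIn-lookup f w t) ⟩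
  length (removeAt (fibre f w) t)           ≡⟨ LP.length-removeAt (fibre f w) t ⟩
  ℕ.pred (fibreSize f w)                   ∎
  where
  open ≡-Reasoning
  j : Fin _
  j = lookup (fibre f w) t
... | no w≢v = trans (sym (LP.length-map (punchIn j) (fibre (f ∘ punchIn j) v)))
                     (cong length (fibre-punchIn-≢ f j v (λ fj≡v → w≢v (trans (sym (fibre-lookup f w t)) fj≡v))))
  where
  j : Fin _
  j = lookup (fibre f w) t

Matching : ∀ {N n} → (Fin N → Fin n) → (Fin N → Fin n) → Set
Matching {n = n} rb cb = ∀ (w : Fin n) → fibreSize rb w ≡ fibreSize cb w

matching-minor : ∀ {N n} (rb cb : Fin (suc N) → Fin n) (t : Fin (fibreSize cb (rb zero))) →
  let j = lookup (fibre cb (rb zero)) t in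
  Matching rb cb ⇔ Matching (rb ∘ suc) (cb ∘ punchIn j)
matching-minor rb cb t = mk⇔
  (λ m w → trans (down (does (rb zero ≟ w)) (trans (sym (fibreSize-suc rb w)) (m w)))
                 (sym (fibreSize-punchIn-lookup cb (rb zero) t w)))
  (λ m w → up w (fibreSize-suc rb w) (trans (m w) (fibreSize-punchIn-lookup cb (rb zero) t w)))
  where
  down : ∀ b {x y} → 𝟙 b ℕ.+ x ≡ y → x ≡ (if b then ℕ.pred y else y)
  down true  y≡ = cong ℕ.pred y≡
  down false y≡ = y≡
  up : ∀ w {x y} → x ≡ 𝟙 (does (rb zero ≟ w)) ℕ.+ y → y ≡ decrementAt (rb zero) (fibreSize cb) w →
       x ≡ fibreSize cb w
  up w x≡ y≡ with rb zero ≟ w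
  ... | yes refl = trans x≡ (trans (cong suc y≡) (suc-pred t))
    where
    suc-pred : ∀ {K} → Fin K → suc (ℕ.pred K) ≡ K
    suc-pred {suc K} _ = refl
  ... | no _ = trans x≡ y≡

sizeBelow : ∀ {n} → Fin n → (Fin n → ℕ) → ℕ
sizeBelow b sz = ℕΣ.sum (λ w → 𝟙 (does (w F.<? b)) ℕ.* sz w)

count-below : ∀ {N n} (f : Fin N → Fin n) b → count (λ c → does (f c F.<? b)) ≡ sizeBelow b (fibreSize f)
count-below {zero} {n} f b = sym (∑-zero n (λ w → ℕP.*-zeroʳ (𝟙 (does (w F.<? b)))))
count-below {suc N} f b = sym (begin
  ℕΣ.sum (λ w → [ w <b] ℕ.* fibreSize f w)
    ≡⟨ ℕΣ.sum-cong-≗ (λ w → trans (cong ([ w <b] ℕ.*_) (fibreSize-suc f w))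
                                   (ℕP.*-distribˡ-+ [ w <b] _ (fibreSize (f ∘ suc) w))) ⟩
  ℕΣ.sum (λ w → [ w <b] ℕ.* 𝟙 (does (f zero ≟ w)) ℕ.+ [ w <b] ℕ.* fibreSize (f ∘ suc) w)
    ≡⟨ ℕΣ.∑-distrib-+ (λ w → [ w <b] ℕ.* 𝟙 (does (f zero ≟ w)))
                      (λ w → [ w <b] ℕ.* fibreSize (f ∘ suc) w) ⟩
  ℕΣ.sum (λ w → [ w <b] ℕ.* 𝟙 (does (f zero ≟ w))) ℕ.+ sizeBelow b (fibreSize (f ∘ suc))
    ≡⟨ cong₂ ℕ._+_ (∑-indicator (f zero) [_<b]) (sym (count-below (f ∘ suc) b)) ⟩
  𝟙 (does (f zero F.<? b)) ℕ.+ count (λ c → does (f (suc c) F.<? b)) ∎)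
  where
  open ≡-Reasoning
  [_<b] : Fin _ → ℕ
  [ w <b] = 𝟙 (does (w F.<? b))

-- Row zero lies in block rb zero, whose columns come after the sizeBelow (rb zero) sz earlier
-- ones; deleting it and one of these columns shrinks that block by one.
blockExponent : ∀ N {n} → (Fin N → Fin n) → (Fin n → ℕ) → ℕ
blockExponent zero    rb sz = 0
blockExponent (suc N) rb sz = sizeBelow (rb zero) sz ℕ.+ blockExponent N (rb ∘ suc) (decrementAt (rb zero) sz)

blockExponent-cong : ∀ N {n} (rb : Fin N → Fin n) {sz sz′ : Fin n → ℕ} → (∀ w → sz w ≡ sz′ w) →
  blockExponent N rb sz ≡ blockExponent N rb sz′
blockExponent-cong zero    rb eq = refl
blockExponent-cong (suc N) rb {sz} {sz′} eq =
  cong₂ ℕ._+_ (ℕΣ.sum-cong-≗ (λ w → cong (𝟙 (does (w F.<? rb zero)) ℕ.*_) (eq w)))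
              (blockExponent-cong N (rb ∘ suc) decrement-eq)
  where
  decrement-eq : ∀ w → decrementAt (rb zero) sz w ≡ decrementAt (rb zero) sz′ w
  decrement-eq w with does (rb zero ≟ w)
  ... | true  = cong ℕ.pred (eq w)
  ... | false = eq w

module Determinant (Rg : CommutativeRing 0ℓ 0ℓ) where
  open CommutativeRing Rg hiding (zero)
    renaming (refl to ≈-refl; sym to ≈-sym; trans to ≈-trans; reflexive to ≈-reflexive)
  open Frame Rg
  open import Algebra.Properties.Ring ring using (-0#≈0#; -‿+-comm; -‿distribʳ-*; -‿distribˡ-*; -‿involutive)
  open import Algebra.Properties.CommutativeSemigroup +-commutativeSemigroup
    using () renaming (interchange to +-interchange)
  open import Algebra.Properties.CommutativeSemigroup *-commutativeSemigroup
    using (x∙yz≈y∙xz) renaming (interchange to *-interchange)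
  open import Relation.Binary.Reasoning.Setoid setoid

  Matrix : ℕ → Set
  Matrix N = Fin N → Fin N → Carrier

  sumFin-cong : ∀ N {f g : Fin N → Carrier} → (∀ i → f i ≈ g i) → sumFin N f ≈ sumFin N g
  sumFin-cong zero    f≈g = ≈-refl
  sumFin-cong (suc N) f≈g = +-cong (f≈g zero) (sumFin-cong N (f≈g ∘ suc))

  sumFin-zero : ∀ N {f : Fin N → Carrier} → (∀ i → f i ≈ 0#) → sumFin N f ≈ 0#
  sumFin-zero zero    f≈0 = ≈-refl
  sumFin-zero (suc N) f≈0 = ≈-trans (+-cong (f≈0 zero) (sumFin-zero N (f≈0 ∘ suc))) (+-identityʳ 0#)

  sumFin-+ : ∀ N (f g : Fin N → Carrier) → sumFin N (λ i → f i + g i) ≈ sumFin N f + sumFin N g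
  sumFin-+ zero    f g = ≈-sym (+-identityʳ 0#)
  sumFin-+ (suc N) f g =
    ≈-trans (+-congˡ (sumFin-+ N (f ∘ suc) (g ∘ suc))) (+-interchange (f zero) (g zero) _ _)

  *-distribˡ-sumFin : ∀ N c (f : Fin N → Carrier) → c * sumFin N f ≈ sumFin N (λ i → c * f i)
  *-distribˡ-sumFin zero    c f = zeroʳ c
  *-distribˡ-sumFin (suc N) c f = ≈-trans (distribˡ c _ _) (+-congˡ (*-distribˡ-sumFin N c (f ∘ suc)))

  -‿sumFin : ∀ N (f : Fin N → Carrier) → - sumFin N f ≈ sumFin N (λ i → - f i)
  -‿sumFin zero    f = -0#≈0#
  -‿sumFin (suc N) f = ≈-trans (≈-sym (-‿+-comm _ _)) (+-congˡ (-‿sumFin N (f ∘ suc)))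

  alt-cong : ∀ i {a b} → a ≈ b → alt i a ≈ alt i b
  alt-cong zero    a≈b = a≈b
  alt-cong (suc i) a≈b = -‿cong (alt-cong i a≈b)

  alt-+ : ∀ i a b → alt i (a + b) ≈ alt i a + alt i b
  alt-+ zero    a b = ≈-refl
  alt-+ (suc i) a b = ≈-trans (-‿cong (alt-+ i a b)) (≈-sym (-‿+-comm _ _))

  alt-0 : ∀ i → alt i 0# ≈ 0#
  alt-0 zero    = ≈-refl
  alt-0 (suc i) = ≈-trans (-‿cong (alt-0 i)) -0#≈0#

  alt-*ˡ : ∀ i c a → alt i (c * a) ≈ c * alt i a
  alt-*ˡ zero    c a = ≈-refl
  alt-*ˡ (suc i) c a = ≈-trans (-‿cong (alt-*ˡ i c a)) (-‿distribʳ-* c (alt i a))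

  alt-*ʳ : ∀ i a c → alt i a * c ≈ alt i (a * c)
  alt-*ʳ i a c = ≈-trans (*-comm (alt i a) c) (≈-trans (≈-sym (alt-*ˡ i c a)) (alt-cong i (*-comm c a)))

  alt-+ℕ : ∀ a b x → alt (a ℕ.+ b) x ≡ alt a (alt b x)
  alt-+ℕ zero    b x = refl
  alt-+ℕ (suc a) b x = cong -_ (alt-+ℕ a b x)

  alt-sgn : ∀ e a → alt e a ≈ sgn (even e) * a
  alt-sgn zero    a = ≈-sym (*-identityˡ a)
  alt-sgn (suc e) a =
    ≈-trans (-‿cong (alt-sgn e a)) (≈-trans (-‿distribˡ-* (sgn (even e)) a) (*-congʳ (-sgn (even e))))
    where
    -sgn : ∀ b → - sgn b ≈ sgn (not b)
    -sgn true  = ≈-refl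
    -sgn false = -‿involutive 1#

  prodFin-cong : ∀ n {f g : Fin n → Carrier} → (∀ i → f i ≈ g i) → prodFin n f ≈ prodFin n g
  prodFin-cong zero    f≈g = ≈-refl
  prodFin-cong (suc n) f≈g = *-cong (f≈g zero) (prodFin-cong n (f≈g ∘ suc))

  prodFin-one : ∀ n {f : Fin n → Carrier} → (∀ i → f i ≈ 1#) → prodFin n f ≈ 1#
  prodFin-one zero    f≈1 = ≈-refl
  prodFin-one (suc n) f≈1 = ≈-trans (*-cong (f≈1 zero) (prodFin-one n (f≈1 ∘ suc))) (*-identityˡ 1#)

  prodFin-zero : ∀ n (f : Fin n → Carrier) i → f i ≈ 0# → prodFin n f ≈ 0#
  prodFin-zero (suc n) f zero    fi≈0 = ≈-trans (*-congʳ fi≈0) (zeroˡ _)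
  prodFin-zero (suc n) f (suc i) fi≈0 = ≈-trans (*-congˡ (prodFin-zero n (f ∘ suc) i fi≈0)) (zeroʳ _)

  prodFin-alt : ∀ n (p : Fin n → ℕ) (f : Fin n → Carrier) →
    prodFin n (λ i → alt (p i) (f i)) ≈ alt (ℕΣ.sum p) (prodFin n f)
  prodFin-alt zero    p f = ≈-refl
  prodFin-alt (suc n) p f = begin
    alt (p zero) (f zero) * prodFin n (λ i → alt (p (suc i)) (f (suc i)))
      ≈⟨ *-congˡ (prodFin-alt n (p ∘ suc) (f ∘ suc)) ⟩
    alt (p zero) (f zero) * alt (ℕΣ.sum (p ∘ suc)) (prodFin n (f ∘ suc))
      ≈⟨ alt-*ʳ (p zero) (f zero) _ ⟩
    alt (p zero) (f zero * alt (ℕΣ.sum (p ∘ suc)) (prodFin n (f ∘ suc)))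
      ≈⟨ alt-cong (p zero) (≈-sym (alt-*ˡ (ℕΣ.sum (p ∘ suc)) (f zero) (prodFin n (f ∘ suc)))) ⟩
    alt (p zero) (alt (ℕΣ.sum (p ∘ suc)) (prodFin (suc n) f))
      ≡⟨ sym (alt-+ℕ (p zero) (ℕΣ.sum (p ∘ suc)) _) ⟩
    alt (ℕΣ.sum p) (prodFin (suc n) f) ∎

  prodFin-isolate : ∀ n (b : Fin n) (f g : Fin n → Carrier) → (∀ w → b ≢ w → f w ≈ g w) →
    prodFin n f ≈ f b * prodFin n (λ w → if does (b ≟ w) then 1# else g w)
  prodFin-isolate (suc n) zero f g f≈g =
    *-congˡ (≈-trans (prodFin-cong n (λ w → f≈g (suc w) (λ ()))) (≈-sym (*-identityˡ _)))
  prodFin-isolate (suc n) (suc b) f g f≈g =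
    ≈-trans (*-cong (f≈g zero (λ ()))
                    (prodFin-isolate n b (f ∘ suc) (g ∘ suc) (λ w b≢w → f≈g (suc w) (b≢w ∘ FP.suc-injective))))
            (x∙yz≈y∙xz (g zero) (f (suc b)) _)

  minor : ∀ {N} → Matrix (suc N) → Fin (suc N) → Matrix N
  minor A j r c = A (suc r) (punchIn j c)

  laplaceTerm : ∀ {N} → Matrix (suc N) → Fin (suc N) → Carrier
  laplaceTerm A j = alt (toℕ j) (A zero j * det (minor A j))

  laplaceTerm-zeroˡ : ∀ {N} (A : Matrix (suc N)) j → A zero j ≈ 0# → laplaceTerm A j ≈ 0#
  laplaceTerm-zeroˡ A j A0j≈0 = ≈-trans (alt-cong (toℕ j) (≈-trans (*-congʳ A0j≈0) (zeroˡ _))) (alt-0 (toℕ j))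

  laplaceTerm-zeroʳ : ∀ {N} (A : Matrix (suc N)) j → det (minor A j) ≈ 0# → laplaceTerm A j ≈ 0#
  laplaceTerm-zeroʳ A j minor≈0 = ≈-trans (alt-cong (toℕ j) (≈-trans (*-congˡ minor≈0) (zeroʳ _))) (alt-0 (toℕ j))

  det-cong : ∀ {N} {A B : Matrix N} → (∀ r c → A r c ≈ B r c) → det A ≈ det B
  det-cong {zero}  A≈B = ≈-refl
  det-cong {suc N} A≈B = sumFin-cong (suc N) (λ j → alt-cong (toℕ j)
    (*-cong (A≈B zero j) (det-cong (λ r c → A≈B (suc r) (punchIn j c)))))

  det-+-row : ∀ {N} (r : Fin N) {A B C : Matrix N} →
    (∀ r′ → r′ ≢ r → ∀ c → A r′ c ≈ B r′ c × A r′ c ≈ C r′ c) →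
    (∀ c → A r c ≈ B r c + C r c) → det A ≈ det B + det C
  det-+-row {suc N} r {A} {B} {C} others row≈ =
    ≈-trans (sumFin-cong (suc N) (term r others row≈)) (sumFin-+ (suc N) (laplaceTerm B) (laplaceTerm C))
    where
    term : ∀ {A B C : Matrix (suc N)} r → (∀ r′ → r′ ≢ r → ∀ c → A r′ c ≈ B r′ c × A r′ c ≈ C r′ c) →
           (∀ c → A r c ≈ B r c + C r c) → ∀ j → laplaceTerm A j ≈ laplaceTerm B j + laplaceTerm C j
    term zero others row≈ j = ≈-trans
      (alt-cong (toℕ j) (≈-trans (*-congʳ (row≈ j)) (distribʳ _ _ _)))
      (≈-trans (alt-+ (toℕ j) _ _)
        (+-cong (alt-cong (toℕ j) (*-congˡ (det-cong (λ r′ c → proj₁ (others (suc r′) (λ ()) (punchIn j c))))))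
                (alt-cong (toℕ j) (*-congˡ (det-cong (λ r′ c → proj₂ (others (suc r′) (λ ()) (punchIn j c))))))))
    term {A} {B} {C} (suc r) others row≈ j = ≈-trans
      (alt-cong (toℕ j) (≈-trans (*-congˡ (det-+-row r {minor A j} {minor B j} {minor C j}
                                   (λ r′ r′≢r c → others (suc r′) (r′≢r ∘ FP.suc-injective) (punchIn j c))
                                   (λ c → row≈ (punchIn j c))))
                                 (distribˡ _ _ _)))
      (≈-trans (alt-+ (toℕ j) _ _)
        (+-cong (alt-cong (toℕ j) (*-congʳ (proj₁ (others zero (λ ()) j))))
                (alt-cong (toℕ j) (*-congʳ (proj₂ (others zero (λ ()) j))))))

  det-zero-row : ∀ {N} (r : Fin N) {A : Matrix N} → (∀ c → A r c ≈ 0#) → det A ≈ 0#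
  det-zero-row {suc N} zero    {A} row≈0 = sumFin-zero (suc N) (λ j → laplaceTerm-zeroˡ A j (row≈0 j))
  det-zero-row {suc N} (suc r) {A} row≈0 =
    sumFin-zero (suc N) (λ j → laplaceTerm-zeroʳ A j (det-zero-row r (row≈0 ∘ punchIn j)))

  setRow : ∀ {N} → Fin N → (Fin N → Carrier) → Matrix N → Matrix N
  setRow r v A r′ c = if does (r′ ≟ r) then v c else A r′ c

  setRow-here : ∀ {N} (r : Fin N) v A c → setRow r v A r c ≡ v c
  setRow-here r v A c rewrite dec-true (r ≟ r) refl = refl

  setRow-there : ∀ {N} {r r′ : Fin N} v A c → r′ ≢ r → setRow r v A r′ c ≡ A r′ c
  setRow-there {r = r} {r′} v A c r′≢r rewrite dec-false (r′ ≟ r) r′≢r = refl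

  setRow-setRow : ∀ {N} (r : Fin N) u v A r′ c → setRow r u (setRow r v A) r′ c ≡ setRow r u A r′ c
  setRow-setRow r u v A r′ c with does (r′ ≟ r)
  ... | true  = refl
  ... | false = refl

  det-∑-row : ∀ {N} (r : Fin N) T (P : Fin T → Fin N → Carrier) (A : Matrix N) →
    (∀ c → A r c ≈ sumFin T (λ t → P t c)) → det A ≈ sumFin T (λ t → det (setRow r (P t) A))
  det-∑-row r zero    P A row≈∑ = det-zero-row r row≈∑
  det-∑-row r (suc T) P A row≈∑ = ≈-trans
    (det-+-row r
      (λ r′ r′≢r c → ≈-reflexive (sym (setRow-there (P zero) A c r′≢r)) , ≈-reflexive (sym (setRow-there rest A c r′≢r)))
      (λ c → ≈-trans (row≈∑ c) (+-cong (≈-reflexive (sym (setRow-here r (P zero) A c)))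
                                        (≈-reflexive (sym (setRow-here r rest A c))))))
    (+-congˡ (≈-trans (det-∑-row r T (P ∘ suc) (setRow r rest A) (λ c → ≈-reflexive (setRow-here r rest A c)))
                      (sumFin-cong T (λ t → det-cong (λ r′ c → ≈-reflexive (setRow-setRow r (P (suc t)) rest A r′ c))))))
    where
    rest : Fin _ → Carrier
    rest c = sumFin T (λ t → P (suc t) c)

  det-scale : ∀ {K} (c : Fin K → Carrier) (B : Matrix K) → det (λ i t → c i * B i t) ≈ prodFin K c * det B
  det-scale {zero}  c B = ≈-sym (*-identityʳ 1#)
  det-scale {suc K} c B = begin
    sumFin (suc K) (λ j → alt (toℕ j) ((c zero * B zero j) * det (λ i t → c (suc i) * minor B j i t)))
      ≈⟨ sumFin-cong (suc K) (λ j → alt-cong (toℕ j)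
           (≈-trans (*-congˡ (det-scale (c ∘ suc) (minor B j)))
                    (*-interchange (c zero) (B zero j) (prodFin K (c ∘ suc)) (det (minor B j))))) ⟩
    sumFin (suc K) (λ j → alt (toℕ j) (prodFin (suc K) c * (B zero j * det (minor B j))))
      ≈⟨ sumFin-cong (suc K) (λ j → alt-*ˡ (toℕ j) (prodFin (suc K) c) (B zero j * det (minor B j))) ⟩
    sumFin (suc K) (λ j → prodFin (suc K) c * laplaceTerm B j)
      ≈⟨ ≈-sym (*-distribˡ-sumFin (suc K) _ (laplaceTerm B)) ⟩
    prodFin (suc K) c * det B ∎

  det-alt-rows : ∀ {K} (p : Fin K → ℕ) (B : Matrix K) → det (λ i t → alt (p i) (B i t)) ≈ alt (ℕΣ.sum p) (det B)
  det-alt-rows {K} p B = begin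
    det (λ i t → alt (p i) (B i t))
      ≈⟨ det-cong (λ i t → ≈-sym (≈-trans (alt-*ʳ (p i) 1# (B i t)) (alt-cong (p i) (*-identityˡ (B i t))))) ⟩
    det (λ i t → alt (p i) 1# * B i t)
      ≈⟨ det-scale (λ i → alt (p i) 1#) B ⟩
    prodFin K (λ i → alt (p i) 1#) * det B
      ≈⟨ *-congʳ (≈-trans (prodFin-alt K p (λ _ → 1#)) (alt-cong (ℕΣ.sum p) (prodFin-one K (λ _ → ≈-refl)))) ⟩
    alt (ℕΣ.sum p) 1# * det B
      ≈⟨ ≈-trans (alt-*ʳ (ℕΣ.sum p) 1# (det B)) (alt-cong (ℕΣ.sum p) (*-identityˡ (det B))) ⟩
    alt (ℕΣ.sum p) (det B) ∎

  det-identity : ∀ {K} (A : Matrix K) → (∀ i t → A i t ≈ (if does (t ≟ i) then 1# else 0#)) → det A ≈ 1#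
  det-identity {zero}  A A≈I = ≈-refl
  det-identity {suc K} A A≈I = begin
    laplaceTerm A zero + sumFin K (λ j → laplaceTerm A (suc j))
      ≈⟨ +-cong (*-cong (A≈I zero zero) (det-identity (minor A zero) (λ i t → A≈I (suc i) (suc t))))
                (sumFin-zero K (λ j → laplaceTerm-zeroˡ A (suc j) (A≈I zero (suc j)))) ⟩
    1# * 1# + 0# ≈⟨ ≈-trans (+-identityʳ _) (*-identityˡ 1#) ⟩
    1# ∎

  -- Each Laplace term vanishes: A zero j is 0, or the minor satisfies the hypothesis again
  -- (for a - 1 when column j < a was deleted).
  det-zero-corner : ∀ K (A : Matrix K) (P : Fin K → Bool) a →
    (∀ i t → P i ≡ true → toℕ t ℕ.< a → A i t ≈ 0#) → K ℕ.∸ a ℕ.< count P → det A ≈ 0#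
  det-zero-corner (suc K) A P a corner≈0 many = sumFin-zero (suc K) vanishing
    where
    vanishing : ∀ j → laplaceTerm A j ≈ 0#
    vanishing j with toℕ j ℕ.<? a | P zero in P₀
    ... | yes j<a | true  = laplaceTerm-zeroˡ A j (corner≈0 zero j P₀ j<a)
    ... | yes j<a | false = laplaceTerm-zeroʳ A j
          (det-zero-corner K (minor A j) (P ∘ suc) (ℕ.pred a) corner′
                           (subst (ℕ._< count (P ∘ suc)) (sym (shrink a j<a)) many))
      where
      shrink : ∀ a → toℕ j ℕ.< a → K ℕ.∸ ℕ.pred a ≡ suc K ℕ.∸ a
      shrink (suc a) _ = refl
      suc-< : ∀ a {x} → toℕ j ℕ.< a → x ℕ.< ℕ.pred a → suc x ℕ.< a
      suc-< (suc a) _ x<a = s≤s x<a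
      corner′ : ∀ i t → P (suc i) ≡ true → toℕ t ℕ.< ℕ.pred a → minor A j i t ≈ 0#
      corner′ i t Pi t<a-1 = corner≈0 (suc i) (punchIn j t) Pi
        (ℕP.≤-<-trans (toℕ-punchIn-≤ j t) (suc-< a j<a t<a-1))
    ... | no j≮a | P0 = laplaceTerm-zeroʳ A j
          (det-zero-corner K (minor A j) (P ∘ suc) a corner′ (ℕ.s≤s⁻¹ (ℕP.≤-trans many′ (𝟙+≤suc P0 _))))
      where
      a≤j : a ≤ toℕ j
      a≤j = ℕP.≮⇒≥ j≮a
      𝟙+≤suc : ∀ b x → 𝟙 b ℕ.+ x ≤ suc x
      𝟙+≤suc true  x = ℕP.≤-refl
      𝟙+≤suc false x = ℕP.n≤1+n x
      many′ : suc (K ℕ.∸ a) ℕ.< 𝟙 P0 ℕ.+ count (P ∘ suc)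
      many′ = subst (ℕ._< 𝟙 P0 ℕ.+ count (P ∘ suc)) (ℕP.+-∸-assoc 1 (ℕP.≤-trans a≤j (ℕ.s≤s⁻¹ (FP.toℕ<n j)))) many
      corner′ : ∀ i t → P (suc i) ≡ true → toℕ t ℕ.< a → minor A j i t ≈ 0#
      corner′ i t Pi t<a = corner≈0 (suc i) (punchIn j t) Pi
        (subst (ℕ._< a) (sym (toℕ-punchIn-< j t (ℕP.<-≤-trans t<a a≤j))) t<a)

module RowExpansion (Rg : CommutativeRing 0ℓ 0ℓ) where
  open CommutativeRing Rg hiding (zero)
    renaming (refl to ≈-refl; sym to ≈-sym; trans to ≈-trans; reflexive to ≈-reflexive)
  open Frame Rg
  open Determinant Rg
  open import Algebra.Properties.CommutativeSemigroup +-commutativeSemigroup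
    using () renaming (interchange to +-interchange)
  open import Relation.Binary.Reasoning.Setoid setoid

  -- The form of the sum in Defs.fanSum.
  sumList : {X : Set} → List X → (X → Carrier) → Carrier
  sumList xs f = foldr _+_ 0# (map f xs)

  sumList-cong : {X : Set} (xs : List X) {f g : X → Carrier} → (∀ x → f x ≈ g x) → sumList xs f ≈ sumList xs g
  sumList-cong []       f≈g = ≈-refl
  sumList-cong (x ∷ xs) f≈g = +-cong (f≈g x) (sumList-cong xs f≈g)

  sumList-++ : {X : Set} (xs ys : List X) (f : X → Carrier) → sumList (xs ++ ys) f ≈ sumList xs f + sumList ys f
  sumList-++ []       ys f = ≈-sym (+-identityˡ _)
  sumList-++ (x ∷ xs) ys f = ≈-trans (+-congˡ (sumList-++ xs ys f)) (≈-sym (+-assoc _ _ _))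

  sumList-concatMap : {X Y : Set} (g : X → List Y) (xs : List X) (f : Y → Carrier) →
    sumList (concatMap g xs) f ≈ sumList xs (λ x → sumList (g x) f)
  sumList-concatMap g []       f = ≈-refl
  sumList-concatMap g (x ∷ xs) f = ≈-trans (sumList-++ (g x) (concatMap g xs) f) (+-congˡ (sumList-concatMap g xs f))

  sumList-map : {X Y : Set} (g : X → Y) (xs : List X) (f : Y → Carrier) → sumList (map g xs) f ≡ sumList xs (f ∘ g)
  sumList-map g xs f = cong (foldr _+_ 0#) (sym (LP.map-∘ xs))

  sumList-tabulate : {X : Set} (n : ℕ) (g : Fin n → X) (f : X → Carrier) → sumList (tabulate g) f ≡ sumFin n (f ∘ g)
  sumList-tabulate zero    g f = refl
  sumList-tabulate (suc n) g f = cong (f (g zero) +_) (sumList-tabulate n (g ∘ suc) f)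

  sumList-zero : {X : Set} (xs : List X) {f : X → Carrier} → (∀ x → f x ≈ 0#) → sumList xs f ≈ 0#
  sumList-zero []       f≈0 = ≈-refl
  sumList-zero (x ∷ xs) f≈0 = ≈-trans (+-cong (f≈0 x) (sumList-zero xs f≈0)) (+-identityʳ 0#)

  sumList-+ : {X : Set} (xs : List X) (f g : X → Carrier) → sumList xs (λ x → f x + g x) ≈ sumList xs f + sumList xs g
  sumList-+ []       f g = ≈-sym (+-identityʳ 0#)
  sumList-+ (x ∷ xs) f g = ≈-trans (+-congˡ (sumList-+ xs f g)) (+-interchange _ _ _ _)

  sumFin-sumList : {X : Set} (n : ℕ) (xs : List X) (F : Fin n → X → Carrier) →
    sumFin n (λ i → sumList xs (F i)) ≈ sumList xs (λ x → sumFin n (λ i → F i x))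
  sumFin-sumList zero    xs F = ≈-sym (sumList-zero xs (λ x → ≈-refl))
  sumFin-sumList (suc n) xs F = ≈-trans (+-congˡ (sumFin-sumList n xs (F ∘ suc))) (≈-sym (sumList-+ xs _ _))

  sumList-filter : {X : Set} {P : Pred X 0ℓ} (P? : Decidable P) (xs : List X) (f g : X → Carrier) →
    (∀ x → ¬ P x → f x ≈ 0#) → (∀ x → P x → f x ≈ g x) → sumList xs f ≈ sumList (filter P? xs) g
  sumList-filter P? []       f g off on = ≈-refl
  sumList-filter P? (x ∷ xs) f g off on with P? x
  ... | yes px = +-cong (on x px) (sumList-filter P? xs f g off on)
  ... | no ¬px = ≈-trans (+-cong (off x ¬px) (sumList-filter P? xs f g off on)) (+-identityˡ _)

  restrict : ∀ {N n} → (Fin N → Fin n) → Fin n → (Fin N → Carrier) → Fin N → Carrier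
  restrict cb w v c = if does (cb c ≟ w) then v c else 0#

  sumFin-indicator : ∀ {n} (a : Fin n) x → sumFin n (λ w → if does (a ≟ w) then x else 0#) ≈ x
  sumFin-indicator {suc n} zero    x = ≈-trans (+-congˡ (sumFin-zero n (λ w → ≈-refl))) (+-identityʳ x)
  sumFin-indicator {suc n} (suc a) x = ≈-trans (+-identityˡ _) (sumFin-indicator a x)

  -- Each row ρ e of B cut down to the columns of block o e.
  restrictRows : ∀ {N n j} → (Fin N → Fin n) → (Fin j → Fin N) → (Fin j → Fin n) → Matrix N → Matrix N
  restrictRows {j = zero}  cb ρ o B = B
  restrictRows {j = suc j} cb ρ o B =
    restrictRows cb (ρ ∘ suc) (o ∘ suc) (setRow (ρ zero) (restrict cb (o zero) (B (ρ zero))) B)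

  det-restrictRows : ∀ {N} n (cb : Fin N → Fin n) j (ρ : Fin j → Fin N) (B : Matrix N) →
    det B ≈ sumList (allFuns j n) (λ o → det (restrictRows cb ρ o B))
  det-restrictRows n cb zero    ρ B = ≈-sym (+-identityʳ _)
  det-restrictRows n cb (suc j) ρ B = begin
    det B
      ≈⟨ det-∑-row (ρ zero) n (λ w → restrict cb w (B (ρ zero))) B
                   (λ c → ≈-sym (sumFin-indicator (cb c) (B (ρ zero) c))) ⟩
    sumFin n (λ w → det (B′ w))
      ≈⟨ sumFin-cong n (λ w → det-restrictRows n cb j (ρ ∘ suc) (B′ w)) ⟩
    sumFin n (λ w → sumList (allFuns j n) (λ o → det (restrictRows cb (ρ ∘ suc) o (B′ w))))
      ≈⟨ sumFin-sumList n (allFuns j n) _ ⟩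
    sumList (allFuns j n) (λ o → sumFin n (λ w → det (restrictRows cb ρ (consF w o) B)))
      ≈⟨ sumList-cong (allFuns j n) (λ o → ≈-reflexive (sym
           (trans (sumList-map (λ w → consF w o) (allFin n) _) (sumList-tabulate n id _)))) ⟩
    sumList (allFuns j n) (λ o → sumList (map (λ w → consF w o) (allFin n)) (λ o′ → det (restrictRows cb ρ o′ B)))
      ≈⟨ ≈-sym (sumList-concatMap _ (allFuns j n) _) ⟩
    sumList (allFuns (suc j) n) (λ o → det (restrictRows cb ρ o B)) ∎
    where
    B′ : Fin n → Matrix _
    B′ w = setRow (ρ zero) (restrict cb w (B (ρ zero))) B

  restrictRows-outside : ∀ {N n j} (cb : Fin N → Fin n) (ρ : Fin j → Fin N) o B r c →
    (∀ e → ρ e ≢ r) → restrictRows cb ρ o B r c ≡ B r c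
  restrictRows-outside {j = zero}  cb ρ o B r c r∉ρ = refl
  restrictRows-outside {j = suc j} cb ρ o B r c r∉ρ =
    trans (restrictRows-outside cb (ρ ∘ suc) (o ∘ suc) _ r c (r∉ρ ∘ suc))
          (setRow-there (restrict cb (o zero) (B (ρ zero))) B c (λ r≡ρ₀ → r∉ρ zero (sym r≡ρ₀)))

  restrictRows-inside : ∀ {N n j} (cb : Fin N → Fin n) (ρ : Fin j → Fin N) o B →
    (∀ {e e′} → ρ e ≡ ρ e′ → e ≡ e′) → ∀ e c → restrictRows cb ρ o B (ρ e) c ≡ restrict cb (o e) (B (ρ e)) c
  restrictRows-inside {j = suc j} cb ρ o B ρ-inj zero c =
    trans (restrictRows-outside cb (ρ ∘ suc) (o ∘ suc) _ (ρ zero) c (λ e ρe≡ρ₀ → FP.0≢1+n (sym (ρ-inj ρe≡ρ₀))))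
          (setRow-here (ρ zero) (restrict cb (o zero) (B (ρ zero))) B c)
  restrictRows-inside {j = suc j} cb ρ o B ρ-inj (suc e) c =
    trans (restrictRows-inside cb (ρ ∘ suc) (o ∘ suc) _ (FP.suc-injective ∘ ρ-inj) e c)
          (cong (λ v → if does (cb c ≟ o (suc e)) then v else 0#)
                (setRow-there (restrict cb (o zero) (B (ρ zero))) B c (λ ρe≡ρ₀ → FP.0≢1+n (sym (ρ-inj ρe≡ρ₀)))))

  restrictRows-by-owner : ∀ {N n j} (cb : Fin N → Fin n) (ρ : Fin j → Fin N) (o : Fin j → Fin n) B
    (owner : Fin N → Fin n) → (∀ {e e′} → ρ e ≡ ρ e′ → e ≡ e′) → (∀ e → owner (ρ e) ≡ o e) →
    (∀ r → Σ[ e ∈ Fin j ] ρ e ≡ r ⊎ ((∀ e → ρ e ≢ r) × (∀ c → cb c ≢ owner r → B r c ≈ 0#))) →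
    ∀ r c → restrictRows cb ρ o B r c ≈ restrict cb (owner r) (B r) c
  restrictRows-by-owner cb ρ o B owner ρ-inj owns rows r c with rows r
  ... | inj₁ (e , refl) = ≈-reflexive (trans (restrictRows-inside cb ρ o B ρ-inj e c)
                                             (cong (λ w → restrict cb w (B (ρ e)) c) (sym (owns e))))
  ... | inj₂ (r∉ρ , off) = ≈-trans (≈-reflexive (restrictRows-outside cb ρ o B r c r∉ρ)) (kept (cb c ≟ owner r))
    where
    kept : (d : Dec (cb c ≡ owner r)) → B r c ≈ (if does d then B r c else 0#)
    kept (yes _)    = ≈-refl
    kept (no c∉r)  = off c c∉r

module BlockDiagonal (Rg : CommutativeRing 0ℓ 0ℓ) where
  open CommutativeRing Rg hiding (zero)
    renaming (refl to ≈-refl; sym to ≈-sym; trans to ≈-trans; reflexive to ≈-reflexive)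
  open Frame Rg
  open Determinant Rg
  open import Algebra.Properties.Ring ring using (-0#≈0#)
  open import Relation.Binary.Reasoning.Setoid setoid

  -- Positions past the end of rs or cs read as 0, so K need not be their length.
  submatrix : {R C : Set} (K : ℕ) → (R → C → Carrier) → List R → List C → Matrix K
  submatrix K A rs cs i t = at 0# (λ r → at 0# (A r) cs (toℕ t)) rs (toℕ i)

  blockDet : {R C : Set} → (R → C → Carrier) → List R → List C → Carrier
  blockDet A rs cs = det (submatrix (length cs) A rs cs)

  blockDet-map : ∀ {R R′ C C′ : Set} (A : R → C → Carrier) (f : R′ → R) (g : C′ → C) rs cs →
    blockDet (λ r c → A (f r) (g c)) rs cs ≈ blockDet A (map f rs) (map g cs)
  blockDet-map A f g rs cs = ≈-trans
    (det-cong {length cs} (λ i t → ≈-reflexive (sym (trans (at-map 0# (λ r → at 0# (A r) (map g cs) (toℕ t)) f rs (toℕ i))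
                                               (at-cong 0# rs (λ r → at-map 0# (A (f r)) g cs (toℕ t)) (toℕ i))))))
    (≈-reflexive (cong (λ K → det (submatrix K A (map f rs) (map g cs))) (sym (LP.length-map g cs))))

  blockDet-cong-rows : ∀ {R C : Set} {P : Pred R 0ℓ} {A B : R → C → Carrier} {rs} cs → All P rs →
    (∀ r → P r → ∀ c → A r c ≈ B r c) → blockDet A rs cs ≈ blockDet B rs cs
  blockDet-cong-rows {A = A} {B} {rs} cs Prs A≈B = det-cong {length cs} (λ i t → rows Prs (toℕ i) (toℕ t))
    where
    rows : ∀ {rs} → All _ rs → ∀ i t → at 0# (λ r → at 0# (A r) cs t) rs i ≈ at 0# (λ r → at 0# (B r) cs t) rs i
    rows []         i       t = ≈-refl
    rows (Pr ∷ Prs) zero    t = columns cs t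
      where
      columns : ∀ cs t → at 0# (A _) cs t ≈ at 0# (B _) cs t
      columns []       t       = ≈-refl
      columns (c ∷ cs) zero    = A≈B _ Pr c
      columns (c ∷ cs) (suc t) = columns cs t
    rows (Pr ∷ Prs) (suc i) t = rows Prs i t

  blockDet-cong : ∀ {R C : Set} {A B : R → C → Carrier} rs cs → (∀ r c → A r c ≈ B r c) →
    blockDet A rs cs ≈ blockDet B rs cs
  blockDet-cong rs cs A≈B = blockDet-cong-rows {P = λ _ → ⊤} cs (All.universal (λ _ → tt) rs) (λ r _ → A≈B r)

  blockDet-allFin : ∀ {R : Set} {K} (A : R → Fin K → Carrier) rs →
    blockDet A rs (allFin K) ≡ det (submatrix K A rs (allFin K))
  blockDet-allFin {K = K} A rs = cong (λ L → det (submatrix L A rs (allFin K))) (LP.length-tabulate {n = K} id)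

  submatrix-allFin : ∀ {R : Set} {K} (A : R → Fin K → Carrier) rs (i t : Fin K) →
    submatrix K A rs (allFin K) i t ≡ at 0# (λ r → A r t) rs (toℕ i)
  submatrix-allFin A rs i t = at-cong 0# rs (λ r → at-tabulate 0# (A r) id t) (toℕ i)

  at-alt : ∀ {X : Set} (q : X → ℕ) (v : X → Carrier) xs i →
    at 0# (λ e → alt (q e) (v e)) xs i ≈ alt (at 0 q xs i) (at 0# v xs i)
  at-alt q v []       i       = ≈-refl
  at-alt q v (x ∷ xs) zero    = ≈-refl
  at-alt q v (x ∷ xs) (suc i) = at-alt q v xs i

  at-cong-All : ∀ {X : Set} {P : Pred X 0ℓ} {f g : X → Carrier} {xs} → All P xs → (∀ x → P x → f x ≈ g x) →
    ∀ i → at 0# f xs i ≈ at 0# g xs i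
  at-cong-All []         f≈g i       = ≈-refl
  at-cong-All (Px ∷ Pxs) f≈g zero    = f≈g _ Px
  at-cong-All (Px ∷ Pxs) f≈g (suc i) = at-cong-All Pxs f≈g i

  at-vanish : ∀ {X : Set} (p : X → Bool) (f : X → Carrier) xs i →
    (∀ x → p x ≡ true → f x ≈ 0#) → at false p xs i ≡ true → at 0# f xs i ≈ 0#
  at-vanish p f (x ∷ xs) zero    f≈0 px = f≈0 x px
  at-vanish p f (x ∷ xs) (suc i) f≈0 pi = at-vanish p f xs i f≈0 pi

  blockDet-laplace : ∀ {R C : Set} (A : R → C → Carrier) r₀ rs (cs : List C) → 0 ℕ.< length cs →
    blockDet A (r₀ ∷ rs) cs ≈
      sumFin (length cs) (λ t → alt (toℕ t) (A r₀ (lookup cs t) * blockDet A rs (removeAt cs t)))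
  blockDet-laplace A r₀ rs (c₀ ∷ cs) _ = sumFin-cong (suc (length cs)) (λ t → alt-cong (toℕ t)
    (*-cong (≈-reflexive (at-lookup 0# (A r₀) (c₀ ∷ cs) t))
            (≈-trans (det-cong (λ i c → ≈-reflexive (at-cong 0# rs (λ r → at-removeAt 0# (A r) c₀ cs t c) (toℕ i))))
                     (≈-reflexive (cong (λ K → det (submatrix K A rs (removeAt (c₀ ∷ cs) t)))
                                        (sym (LP.length-removeAt (c₀ ∷ cs) t)))))))

  altSum : ∀ {N} → List (Fin N) → (Fin N → Carrier) → Carrier
  altSum []       f = 0#
  altSum (x ∷ xs) f = f x + - altSum xs f

  altSum-map-suc : ∀ {N} (xs : List (Fin N)) (f : Fin (suc N) → Carrier) → altSum (map suc xs) f ≡ altSum xs (f ∘ suc)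
  altSum-map-suc []       f = refl
  altSum-map-suc (x ∷ xs) f = cong (λ s → f (suc x) + - s) (altSum-map-suc xs f)

  altSum-lookup : ∀ {N} (xs : List (Fin N)) f → sumFin (length xs) (λ t → alt (toℕ t) (f (lookup xs t))) ≈ altSum xs f
  altSum-lookup []       f = ≈-refl
  altSum-lookup (x ∷ xs) f =
    +-congˡ (≈-trans (≈-sym (-‿sumFin (length xs) (λ t → alt (toℕ t) (f (lookup xs t))))) (-‿cong (altSum-lookup xs f)))

  -- For monotone cb the fibre of b is a run of consecutive columns, preceded by those with cb c < b.
  ∑-alt-fibre : ∀ N {n} (cb : Fin N → Fin n) b (f : Fin N → Carrier) → Monotone cb → (∀ j → cb j ≢ b → f j ≈ 0#) →
    sumFin N (λ j → alt (toℕ j) (f j)) ≈ alt (count (λ c → does (cb c F.<? b))) (altSum (fibre cb b) f)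
  ∑-alt-fibre zero    cb b f mono off = ≈-refl
  ∑-alt-fibre (suc N) cb b f mono off = begin
    f zero + sumFin N (λ j → - alt (toℕ j) (f (suc j)))
      ≈⟨ +-congˡ (≈-trans (≈-sym (-‿sumFin N (λ j → alt (toℕ j) (f (suc j)))))
                          (-‿cong (∑-alt-fibre N (cb ∘ suc) b (f ∘ suc) (mono ∘ s≤s) (off ∘ suc)))) ⟩
    f zero + - alt c′ (altSum l′ (f ∘ suc))
      ≈⟨ head (FP.<-cmp (cb zero) b) ⟩
    alt (𝟙 (does (cb zero F.<? b)) ℕ.+ c′) (altSum (if does (cb zero ≟ b) then zero ∷ map suc l′ else map suc l′) f)
      ≡⟨ cong (λ l → alt (count (λ c → does (cb c F.<? b))) (altSum l f)) (sym (filter-allFin-suc (λ c → cb c ≟ b))) ⟩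
    alt (count (λ c → does (cb c F.<? b))) (altSum (fibre cb b) f) ∎
    where
    c′ : ℕ
    c′ = count (λ c → does (cb (suc c) F.<? b))
    l′ : List (Fin N)
    l′ = fibre (cb ∘ suc) b
    cb₀≤ : ∀ c → cb zero F.≤ cb (suc c)
    cb₀≤ c = mono z≤n
    above-empty : b F.< cb zero → l′ ≡ []
    above-empty gt = LP.filter-none (λ c → cb (suc c) ≟ b)
      (All.universal (λ c eq → ℕP.<⇒≱ gt (subst (cb zero F.≤_) eq (cb₀≤ c))) (allFin N))
    head : Tri (cb zero F.< b) (cb zero ≡ b) (b F.< cb zero) →
           f zero + - alt c′ (altSum l′ (f ∘ suc)) ≈
           alt (𝟙 (does (cb zero F.<? b)) ℕ.+ c′) (altSum (if does (cb zero ≟ b) then zero ∷ map suc l′ else map suc l′) f)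
    head (tri< lt ¬eq _) rewrite dec-true (cb zero F.<? b) lt | dec-false (cb zero ≟ b) ¬eq | altSum-map-suc l′ f =
      ≈-trans (+-congʳ (off zero ¬eq)) (+-identityˡ _)
    head (tri≈ ¬lt eq _) rewrite dec-false (cb zero F.<? b) ¬lt | dec-true (cb zero ≟ b) eq | altSum-map-suc l′ f =
      at-zero none-below
      where
      at-zero : ∀ {e} → e ≡ 0 → f zero + - alt e (altSum l′ (f ∘ suc)) ≈ alt e (f zero + - altSum l′ (f ∘ suc))
      at-zero refl = ≈-refl
      none-below : c′ ≡ 0
      none-below = ∑-zero N (λ c → cong 𝟙 (dec-false (cb (suc c) F.<? b)
                     (λ lt → ℕP.<⇒≱ lt (subst (F._≤ cb (suc c)) eq (cb₀≤ c)))))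
    head (tri> ¬lt ¬eq gt) rewrite dec-false (cb zero F.<? b) ¬lt | dec-false (cb zero ≟ b) ¬eq | above-empty gt =
      ≈-trans (+-cong (off zero ¬eq) (≈-trans (-‿cong (alt-0 c′)) -0#≈0#))
              (≈-trans (+-identityʳ 0#) (≈-sym (alt-0 c′)))

  BlockSupported : ∀ {N n} (rb cb : Fin N → Fin n) → Matrix N → Set
  BlockSupported rb cb A = ∀ r c → cb c ≢ rb r → A r c ≈ 0#

  blockProduct : ∀ {N n} (rb cb : Fin N → Fin n) → Matrix N → Carrier
  blockProduct {n = n} rb cb A = prodFin n (λ w → blockDet A (fibre rb w) (fibre cb w))

  det-firstRow : ∀ {N n} (rb cb : Fin (suc N) → Fin n) (A : Matrix (suc N)) → Monotone cb → BlockSupported rb cb A →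
    let col = lookup (fibre cb (rb zero)) in
    det A ≈ alt (sizeBelow (rb zero) (fibreSize cb))
                (sumFin (fibreSize cb (rb zero)) (λ t → alt (toℕ t) (A zero (col t) * det (minor A (col t)))))
  det-firstRow {N} rb cb A mono supp = begin
    sumFin (suc N) (λ j → alt (toℕ j) (A zero j * det (minor A j)))
      ≈⟨ ∑-alt-fibre (suc N) cb (rb zero) (λ j → A zero j * det (minor A j)) mono
                     (λ j cbj≢ → ≈-trans (*-congʳ (supp zero j cbj≢)) (zeroˡ _)) ⟩
    alt (count (λ c → does (cb c F.<? rb zero))) (altSum (fibre cb (rb zero)) (λ j → A zero j * det (minor A j)))
      ≈⟨ ≈-reflexive (cong₂ alt (count-below cb (rb zero)) refl) ⟩
    alt (sizeBelow (rb zero) (fibreSize cb)) (altSum (fibre cb (rb zero)) (λ j → A zero j * det (minor A j)))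
      ≈⟨ alt-cong (sizeBelow (rb zero) (fibreSize cb))
                  (≈-sym (altSum-lookup (fibre cb (rb zero)) (λ j → A zero j * det (minor A j)))) ⟩
    alt (sizeBelow (rb zero) (fibreSize cb))
        (sumFin (fibreSize cb (rb zero)) (λ t → alt (toℕ t) (A zero (col t) * det (minor A (col t))))) ∎
    where
    col : Fin (fibreSize cb (rb zero)) → Fin (suc N)
    col = lookup (fibre cb (rb zero))

  det-blockMismatch : ∀ N {n} (rb cb : Fin N → Fin n) (A : Matrix N) → Monotone cb → BlockSupported rb cb A →
    ¬ Matching rb cb → det A ≈ 0#
  det-blockMismatch zero    rb cb A mono supp mismatch = contradiction (λ w → refl) mismatch
  det-blockMismatch (suc N) rb cb A mono supp mismatch =
    ≈-trans (det-firstRow rb cb A mono supp)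
            (≈-trans (alt-cong (sizeBelow (rb zero) (fibreSize cb)) (sumFin-zero (fibreSize cb (rb zero)) vanishing))
                     (alt-0 (sizeBelow (rb zero) (fibreSize cb))))
    where
    vanishing : ∀ t → let j = lookup (fibre cb (rb zero)) t in alt (toℕ t) (A zero j * det (minor A j)) ≈ 0#
    vanishing t = ≈-trans (alt-cong (toℕ t) (≈-trans (*-congˡ minor≈0) (zeroʳ _))) (alt-0 (toℕ t))
      where
      j : Fin (suc N)
      j = lookup (fibre cb (rb zero)) t
      minor≈0 : det (minor A j) ≈ 0#
      minor≈0 = det-blockMismatch N (rb ∘ suc) (cb ∘ punchIn j) (minor A j) (monotone-punchIn j mono)
                  (λ r c → supp (suc r) (punchIn j c)) (mismatch ∘ Equivalence.from (matching-minor rb cb t))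

  blockProduct-minor : ∀ {N n} (rb cb : Fin (suc N) → Fin n) (A : Matrix (suc N)) (t : Fin (fibreSize cb (rb zero))) →
    let b₀ = rb zero ; j = lookup (fibre cb b₀) t in
    blockProduct (rb ∘ suc) (cb ∘ punchIn j) (minor A j) ≈
      blockDet A (map suc (fibre (rb ∘ suc) b₀)) (removeAt (fibre cb b₀) t) *
      prodFin n (λ w → if does (b₀ ≟ w) then 1# else blockDet A (fibre rb w) (fibre cb w))
  blockProduct-minor {n = n} rb cb A t = begin
    prodFin n (λ w → blockDet (minor A j) (fibre (rb ∘ suc) w) (fibre (cb ∘ punchIn j) w))
      ≈⟨ prodFin-cong n (λ w → blockDet-map A suc (punchIn j) (fibre (rb ∘ suc) w) (fibre (cb ∘ punchIn j) w)) ⟩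
    prodFin n minorBlock
      ≈⟨ prodFin-isolate n b₀ minorBlock (λ w → blockDet A (fibre rb w) (fibre cb w)) away ⟩
    minorBlock b₀ * others
      ≡⟨ cong (λ cs → blockDet A (map suc (fibre (rb ∘ suc) b₀)) cs * others) (fibre-punchIn-lookup cb b₀ t) ⟩
    blockDet A (map suc (fibre (rb ∘ suc) b₀)) (removeAt (fibre cb b₀) t) * others ∎
    where
    b₀ : Fin n
    b₀ = rb zero
    j : Fin _
    j = lookup (fibre cb b₀) t
    minorBlock : Fin n → Carrier
    minorBlock w = blockDet A (map suc (fibre (rb ∘ suc) w)) (map (punchIn j) (fibre (cb ∘ punchIn j) w))
    others : Carrier
    others = prodFin n (λ w → if does (b₀ ≟ w) then 1# else blockDet A (fibre rb w) (fibre cb w))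
    away : ∀ w → b₀ ≢ w → minorBlock w ≈ blockDet A (fibre rb w) (fibre cb w)
    away w b₀≢w = ≈-reflexive (cong₂ (blockDet A) (sym (fibre-suc-≢ rb w b₀≢w))
      (fibre-punchIn-≢ cb j w (λ cbj≡w → b₀≢w (trans (sym (fibre-lookup cb b₀ t)) cbj≡w))))

  det-blockDiagonal : ∀ N {n} (rb cb : Fin N → Fin n) (A : Matrix N) → Monotone cb → BlockSupported rb cb A →
    Matching rb cb → det A ≈ alt (blockExponent N rb (fibreSize cb)) (blockProduct rb cb A)
  det-blockDiagonal zero {n} rb cb A mono supp match = ≈-sym (prodFin-one n (λ w → ≈-refl))
  det-blockDiagonal (suc N) {n} rb cb A mono supp match = begin
    det A
      ≈⟨ det-firstRow rb cb A mono supp ⟩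
    alt e₀ (sumFin L (λ t → alt (toℕ t) (A zero (col t) * det (minor A (col t)))))
      ≈⟨ alt-cong e₀ (sumFin-cong L (λ t → alt-cong (toℕ t) (*-congˡ (minor≈ t)))) ⟩
    alt e₀ (sumFin L (λ t → alt (toℕ t) (A zero (col t) * alt e′ (X t * others))))
      ≈⟨ alt-cong e₀ (sumFin-cong L (λ t → pull (toℕ t) (A zero (col t)) (X t))) ⟩
    alt e₀ (sumFin L (λ t → alt e′ others * alt (toℕ t) (A zero (col t) * X t)))
      ≈⟨ alt-cong e₀ (≈-sym (*-distribˡ-sumFin L (alt e′ others) _)) ⟩
    alt e₀ (alt e′ others * sumFin L (λ t → alt (toℕ t) (A zero (col t) * X t)))
      ≈⟨ alt-cong e₀ (*-congˡ (≈-sym block₀-laplace)) ⟩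
    alt e₀ (alt e′ others * block b₀)
      ≈⟨ alt-cong e₀ (≈-trans (alt-*ʳ e′ others (block b₀)) (alt-cong e′ (*-comm others (block b₀)))) ⟩
    alt e₀ (alt e′ (block b₀ * others))
      ≡⟨ sym (alt-+ℕ e₀ e′ _) ⟩
    alt (e₀ ℕ.+ e′) (block b₀ * others)
      ≈⟨ alt-cong (e₀ ℕ.+ e′) (≈-sym (prodFin-isolate n b₀ block block (λ _ _ → ≈-refl))) ⟩
    alt (e₀ ℕ.+ e′) (blockProduct rb cb A) ∎
    where
    b₀ : Fin n
    b₀ = rb zero
    L : ℕ
    L = fibreSize cb b₀
    col : Fin L → Fin (suc N)
    col = lookup (fibre cb b₀)
    e₀ e′ : ℕ
    e₀ = sizeBelow b₀ (fibreSize cb)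
    e′ = blockExponent N (rb ∘ suc) (decrementAt b₀ (fibreSize cb))
    block : Fin n → Carrier
    block w = blockDet A (fibre rb w) (fibre cb w)
    others : Carrier
    others = prodFin n (λ w → if does (b₀ ≟ w) then 1# else block w)
    X : Fin L → Carrier
    X t = blockDet A (map suc (fibre (rb ∘ suc) b₀)) (removeAt (fibre cb b₀) t)
    minor≈ : ∀ t → det (minor A (col t)) ≈ alt e′ (X t * others)
    minor≈ t = ≈-trans
      (det-blockDiagonal N (rb ∘ suc) (cb ∘ punchIn (col t)) (minor A (col t)) (monotone-punchIn (col t) mono)
        (λ r c → supp (suc r) (punchIn (col t) c)) (Equivalence.to (matching-minor rb cb t) match))
      (≈-trans (≈-reflexive (cong₂ alt (blockExponent-cong N (rb ∘ suc) (fibreSize-punchIn-lookup cb b₀ t)) refl))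
               (alt-cong e′ (blockProduct-minor rb cb A t)))
    pull : ∀ i a x → alt i (a * alt e′ (x * others)) ≈ alt e′ others * alt i (a * x)
    pull i a x = ≈-trans (alt-cong i (≈-trans (*-congˡ (alt-*ˡ e′ x others))
                                               (≈-trans (≈-sym (*-assoc a x _)) (*-comm (a * x) _))))
                         (alt-*ˡ i (alt e′ others) (a * x))
    nonempty : 0 ℕ.< L
    nonempty = subst (0 ℕ.<_) (trans (sym (cong length (fibre-suc-head rb))) (match b₀)) (s≤s z≤n)
    block₀-laplace : block b₀ ≈ sumFin L (λ t → alt (toℕ t) (A zero (col t) * X t))
    block₀-laplace = ≈-trans (≈-reflexive (cong (λ rs → blockDet A rs (fibre cb b₀)) (fibre-suc-head rb)))
                             (blockDet-laplace A zero (map suc (fibre (rb ∘ suc) b₀)) (fibre cb b₀) nonempty)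

-- The rigidity matrix

quotient-↑ˡ : ∀ {n} k (i : Fin k) → F.quotient {suc n} k (i F.↑ˡ (n ℕ.* k)) ≡ zero
quotient-↑ˡ {n} k i rewrite FP.splitAt-↑ˡ k i (n ℕ.* k) = refl

quotient-↑ʳ : ∀ {n} k (j : Fin (n ℕ.* k)) → F.quotient {suc n} k (k F.↑ʳ j) ≡ suc (F.quotient {n} k j)
quotient-↑ʳ {n} k j rewrite FP.splitAt-↑ʳ k (n ℕ.* k) j = refl

fibre-quotient : ∀ {n} k (w : Fin n) → fibre (F.quotient {n} k) w ≡ map (F.combine w) (allFin k)
fibre-quotient {suc n} k w = begin
  fibre q w
    ≡⟨ fibre-+ {k} {n ℕ.* k} q w ⟩
  map (F._↑ˡ (n ℕ.* k)) (fibre (q ∘ (F._↑ˡ (n ℕ.* k))) w) ++ map (k F.↑ʳ_) (fibre (q ∘ (k F.↑ʳ_)) w)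
    ≡⟨ cong₂ (λ l l′ → map (F._↑ˡ (n ℕ.* k)) l ++ map (k F.↑ʳ_) l′)
             (trans (fibre-cong (quotient-↑ˡ k) w) (fibre-const zero w))
             (fibre-cong (quotient-↑ʳ k) w) ⟩
  map (F._↑ˡ (n ℕ.* k)) (if does (zero ≟ w) then allFin k else []) ++ map (k F.↑ʳ_) (fibre (suc ∘ q′) w)
    ≡⟨ blocks w ⟩
  map (F.combine w) (allFin k) ∎
  where
  open ≡-Reasoning
  q : Fin (suc n ℕ.* k) → Fin (suc n)
  q = F.quotient k
  q′ : Fin (n ℕ.* k) → Fin n
  q′ = F.quotient k
  blocks : ∀ w → map (F._↑ˡ (n ℕ.* k)) (if does (zero ≟ w) then allFin k else []) ++ map (k F.↑ʳ_) (fibre (suc ∘ q′) w)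
                 ≡ map (F.combine w) (allFin k)
  blocks zero    = trans (cong (λ l → map (F._↑ˡ (n ℕ.* k)) (allFin k) ++ map (k F.↑ʳ_) l)
                               (LP.filter-none (λ c → suc (q′ c) ≟ zero) (All.universal (λ c ()) (allFin _))))
                         (LP.++-identityʳ _)
  blocks (suc w) = trans (cong (map (k F.↑ʳ_)) (trans (fibre-suc∘ q′ w) (fibre-quotient k w)))
                         (sym (LP.map-∘ (allFin k)))

fibreSize-quotient : ∀ {n} k (w : Fin n) → fibreSize (F.quotient {n} k) w ≡ k
fibreSize-quotient k w = trans (cong length (fibre-quotient k w))
                               (trans (LP.length-map (F.combine w) (allFin k)) (LP.length-tabulate id))

toℕ-remQuot : ∀ {n} k (c : Fin (n ℕ.* k)) → toℕ c ≡ k ℕ.* toℕ (F.quotient {n} k c) ℕ.+ toℕ (F.remainder {n} k c)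
toℕ-remQuot {n} k c = trans (cong toℕ (sym (FP.combine-remQuot {n} k c)))
                            (FP.toℕ-combine (F.quotient {n} k c) (F.remainder {n} k c))

quotient-monotone : ∀ {n} k → Monotone (F.quotient {n} k)
quotient-monotone {n} k {c} {c′} c≤c′ with toℕ (F.quotient {n} k c) ℕ.≤? toℕ (F.quotient {n} k c′)
... | yes q≤q′ = q≤q′
... | no  q≰q′ = contradiction (ℕP.≤-<-trans (subst (_≤ toℕ c′) (toℕ-remQuot k c) c≤c′) c′<) (ℕP.<-irrefl refl)
  where
  open ℕP.≤-Reasoning
  c′< : toℕ c′ ℕ.< k ℕ.* toℕ (F.quotient {n} k c) ℕ.+ toℕ (F.remainder {n} k c)
  c′< = begin-strict
    toℕ c′                                                          ≡⟨ toℕ-remQuot k c′ ⟩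
    k ℕ.* toℕ (F.quotient {n} k c′) ℕ.+ toℕ (F.remainder {n} k c′)  <⟨ ℕP.+-monoʳ-< _ (FP.toℕ<n (F.remainder {n} k c′)) ⟩
    k ℕ.* toℕ (F.quotient {n} k c′) ℕ.+ k                            ≡⟨ ℕP.+-comm _ k ⟩
    k ℕ.+ k ℕ.* toℕ (F.quotient {n} k c′)                            ≡⟨ sym (ℕP.*-suc k _) ⟩
    k ℕ.* suc (toℕ (F.quotient {n} k c′))                            ≤⟨ ℕP.*-monoʳ-≤ k (ℕP.≰⇒> q≰q′) ⟩
    k ℕ.* toℕ (F.quotient {n} k c)                                   ≤⟨ ℕP.m≤m+n _ _ ⟩
    k ℕ.* toℕ (F.quotient {n} k c) ℕ.+ toℕ (F.remainder {n} k c)    ∎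

-- Rows of M_T: edge e belongs to o e, the k appended identity rows to vertex 1 (Fin zero).
rowVertex : ∀ {m n} k → (Fin m → Fin (suc n)) → Fin (m ℕ.+ k) → Fin (suc n)
rowVertex {m} k o y = [ o , (λ _ → zero) ]′ (F.splitAt m y)

rowVertex-↑ˡ : ∀ {m n} k (o : Fin m → Fin (suc n)) e → rowVertex k o (e F.↑ˡ k) ≡ o e
rowVertex-↑ˡ {m} k o e = cong [ o , (λ _ → zero) ]′ (FP.splitAt-↑ˡ m e k)

rowVertex-↑ʳ : ∀ {m n} k (o : Fin m → Fin (suc n)) t → rowVertex k o (m F.↑ʳ t) ≡ zero
rowVertex-↑ʳ {m} k o t = cong [ o , (λ _ → zero) ]′ (FP.splitAt-↑ʳ m k t)

fibre-rowVertex : ∀ {m n} k (o : Fin m → Fin (suc n)) w →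
  fibre (rowVertex k o) w ≡ map (F._↑ˡ k) (fibre o w) ++ map (m F.↑ʳ_) (if does (zero ≟ w) then allFin k else [])
fibre-rowVertex {m} k o w = trans (fibre-+ {m} {k} (rowVertex k o) w)
  (cong₂ (λ l l′ → map (F._↑ˡ k) l ++ map (m F.↑ʳ_) l′)
         (fibre-cong (rowVertex-↑ˡ k o) w)
         (trans (fibre-cong (rowVertex-↑ʳ k o) w) (fibre-const zero w)))

fibreSize-rowVertex : ∀ {m n} k (o : Fin m → Fin (suc n)) w →
  fibreSize (rowVertex k o) w ≡ fibreSize o w ℕ.+ (if does (zero ≟ w) then k else 0)
fibreSize-rowVertex {m} k o w = begin
  fibreSize (rowVertex k o) w
    ≡⟨ cong length (fibre-rowVertex k o w) ⟩
  length (map (F._↑ˡ k) (fibre o w) ++ map (m F.↑ʳ_) (if does (zero ≟ w) then allFin k else []))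
    ≡⟨ LP.length-++ (map (F._↑ˡ k) (fibre o w)) ⟩
  length (map (F._↑ˡ k) (fibre o w)) ℕ.+ length (map (m F.↑ʳ_) (if does (zero ≟ w) then allFin k else []))
    ≡⟨ cong₂ ℕ._+_ (LP.length-map (F._↑ˡ k) (fibre o w))
                   (trans (LP.length-map (m F.↑ʳ_) (if does (zero ≟ w) then allFin k else []))
                          (lengthIf (does (zero ≟ w)))) ⟩
  fibreSize o w ℕ.+ (if does (zero ≟ w) then k else 0) ∎
  where
  open ≡-Reasoning
  lengthIf : ∀ b → length (if b then allFin k else []) ≡ (if b then k else 0)
  lengthIf true  = LP.length-tabulate id
  lengthIf false = refl

-- x(e) enters the columns of src e with sign + and those of tgt e with sign −.
orientation : ∀ {n m} → BiGraph n m → Fin m → Fin n → ℕ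
orientation H e w = 𝟙 (not (does (w ≟ src H e)))

orientationSum : ∀ {n m} k → BiGraph n m → (Fin m → Fin n) → Fin n → ℕ
orientationSum k H o w = ℕΣ.sum {k} (λ i → at 0 (λ e → orientation H e w) (fibre o w) (toℕ i))

fanSign : ∀ k {n m} (H : BiGraph (suc n) m) → suc n ℕ.* k ≡ m ℕ.+ k → (Fin m → Fin (suc n)) → Bool
fanSign k {n} H sq o = even (blockExponent (suc n ℕ.* k) (rowVertex k o ∘ F.cast sq) (fibreSize (F.quotient {suc n} k))
                              ℕ.+ ℕΣ.sum (orientationSum k H o))

module Expansion (Rg : CommutativeRing 0ℓ 0ℓ) {k g n m : ℕ} {H : BiGraph (suc n) m}
                 (sq : suc n ℕ.* k ≡ m ℕ.+ k) (x : Frame.Frame Rg k g H) where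
  open CommutativeRing Rg hiding (zero)
    renaming (refl to ≈-refl; sym to ≈-sym; trans to ≈-trans; reflexive to ≈-reflexive)
  open Frame Rg
  open Determinant Rg
  open RowExpansion Rg
  open BlockDiagonal Rg
  open import Algebra.Properties.Ring ring using (-0#≈0#)

  rowsMatrix-at : ∀ {K} {X : Set} (V : X → Fin K → Carrier) xs (i t : Fin K) →
    rowsMatrix (map V xs) i t ≡ at 0# (λ e → V e t) xs (toℕ i)
  rowsMatrix-at V []       i       t = refl
  rowsMatrix-at V (x ∷ xs) zero    t = refl
  rowsMatrix-at V (x ∷ xs) (suc i) t =
    trans (rowsMatrix-at V xs (F.inject₁ i) t) (cong (at 0# (λ e → V e t) xs) (FP.toℕ-inject₁ i))

  vertexOf : Fin (suc n ℕ.* k) → Fin (suc n)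
  vertexOf = F.quotient {suc n} k

  column : Fin (suc n) → Fin k → Fin (suc n ℕ.* k)
  column = F.combine

  MT-↑ˡ : ∀ e c → MT x (e F.↑ˡ k) c ≡ rigEntry x e (vertexOf c) (F.remainder {suc n} k c)
  MT-↑ˡ e c rewrite FP.splitAt-↑ˡ m e k = refl

  MT-↑ʳ-outside : ∀ t c → vertexOf c ≢ zero → MT x (m F.↑ʳ t) c ≡ 0#
  MT-↑ʳ-outside t c c∉₀ rewrite FP.splitAt-↑ʳ m k t with toℕ (vertexOf c) ℕ.≟ 0
  ... | yes c∈₀ = contradiction (FP.toℕ-injective c∈₀) c∉₀
  ... | no _    = refl

  MT-↑ʳ-combine : ∀ t j → MT x (m F.↑ʳ t) (column zero j) ≡ (if does (j ≟ t) then 1# else 0#)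
  MT-↑ʳ-combine t j rewrite FP.splitAt-↑ʳ m k t | FP.splitAt-↑ˡ k j (n ℕ.* k) with j ≟ t
  ... | yes _ = refl
  ... | no  _ = refl

  M : Matrix (suc n ℕ.* k)
  M r c = MT x (F.cast sq r) c

  restrictedRow : (Fin m → Fin (suc n)) → Fin (m ℕ.+ k) → Fin (suc n ℕ.* k) → Carrier
  restrictedRow o y = restrict vertexOf (rowVertex k o y) (MT x y)

  restricted : (Fin m → Fin (suc n)) → Matrix (suc n ℕ.* k)
  restricted o r = restrictedRow o (F.cast sq r)

  rowOwner : (Fin m → Fin (suc n)) → Fin (suc n ℕ.* k) → Fin (suc n)
  rowOwner o = rowVertex k o ∘ F.cast sq

  edgeRow : Fin m → Fin (suc n ℕ.* k)
  edgeRow e = F.cast (sym sq) (e F.↑ˡ k)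

  cast-edgeRow : ∀ e → F.cast sq (edgeRow e) ≡ e F.↑ˡ k
  cast-edgeRow e = FP.cast-involutive sq (sym sq) (e F.↑ˡ k)

  edgeRow-injective : ∀ {e e′} → edgeRow e ≡ edgeRow e′ → e ≡ e′
  edgeRow-injective {e} {e′} eq =
    FP.↑ˡ-injective k e e′ (trans (sym (cast-edgeRow e)) (trans (cong (F.cast sq) eq) (cast-edgeRow e′)))

  rowKind : ∀ o r → Σ[ e ∈ Fin m ] edgeRow e ≡ r ⊎
                    ((∀ e → edgeRow e ≢ r) × (∀ c → vertexOf c ≢ rowOwner o r → M r c ≈ 0#))
  rowKind o r = classify (F.splitAt m (F.cast sq r)) refl
    where
    classify : ∀ s → F.splitAt m (F.cast sq r) ≡ s → Σ[ e ∈ Fin m ] edgeRow e ≡ r ⊎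
               ((∀ e → edgeRow e ≢ r) × (∀ c → vertexOf c ≢ rowOwner o r → M r c ≈ 0#))
    classify (inj₁ e) split =
      inj₁ (e , trans (cong (F.cast (sym sq)) (FP.splitAt⁻¹-↑ˡ split)) (FP.cast-involutive (sym sq) sq r))
    classify (inj₂ t) split = inj₂ (notEdge , outside)
      where
      r≡ : m F.↑ʳ t ≡ F.cast sq r
      r≡ = FP.splitAt⁻¹-↑ʳ split
      notEdge : ∀ e → edgeRow e ≢ r
      notEdge e refl with trans (sym (FP.splitAt-↑ˡ m e k)) (trans (cong (F.splitAt m) (sym (cast-edgeRow e))) split)
      ... | ()
      outside : ∀ c → vertexOf c ≢ rowOwner o r → M r c ≈ 0#
      outside c c∉ = ≈-reflexive (trans (cong (λ y → MT x y c) (sym r≡))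
        (MT-↑ʳ-outside t c (λ c∈₀ → c∉ (trans c∈₀ (sym (trans (cong (rowVertex k o) (sym r≡)) (rowVertex-↑ʳ k o t)))))))

  det-M-expansion : det M ≈ sumList (allFuns m (suc n)) (λ o → det (restricted o))
  det-M-expansion = ≈-trans (det-restrictRows (suc n) vertexOf m edgeRow M)
    (sumList-cong (allFuns m (suc n)) (λ o → det-cong
      (restrictRows-by-owner vertexOf edgeRow o M (rowOwner o) edgeRow-injective
        (λ e → trans (cong (rowVertex k o) (cast-edgeRow e)) (rowVertex-↑ˡ k o e)) (rowKind o))))

  supported : ∀ o → BlockSupported (rowOwner o) vertexOf (restricted o)
  supported o r c c∉ rewrite dec-false (vertexOf c ≟ rowOwner o r) c∉ = ≈-refl

  block : (Fin m → Fin (suc n)) → Fin (suc n) → Carrier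
  block o w = blockDet (restricted o) (fibre (rowOwner o) w) (fibre vertexOf w)

  vertexOf-combine : ∀ w t → vertexOf (column w t) ≡ w
  vertexOf-combine w t = cong proj₁ (FP.remQuot-combine {suc n} {k} w t)

  remainder-combine : ∀ w t → F.remainder {suc n} k (column w t) ≡ t
  remainder-combine w t = cong proj₂ (FP.remQuot-combine {suc n} {k} w t)

  block≈restrictedRows : ∀ o w →
    block o w ≈ blockDet (λ y t → restrictedRow o y (column w t)) (fibre (rowVertex k o) w) (allFin k)
  block≈restrictedRows o w = begin
    block o w
      ≡⟨ cong₂ (blockDet (restricted o)) (fibre-cast (sym sq) (rowVertex k o) w) (fibre-quotient k w) ⟩
    blockDet (restricted o) (map (F.cast (sym sq)) (fibre (rowVertex k o) w)) (map (column w) (allFin k))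
      ≈⟨ ≈-sym (blockDet-map (restricted o) (F.cast (sym sq)) (column w) (fibre (rowVertex k o) w) (allFin k)) ⟩
    blockDet (λ y t → restricted o (F.cast (sym sq) y) (column w t)) (fibre (rowVertex k o) w) (allFin k)
      ≈⟨ blockDet-cong (fibre (rowVertex k o) w) (allFin k)
           (λ y t → ≈-reflexive (cong (λ y′ → restrictedRow o y′ (column w t)) (FP.cast-involutive sq (sym sq) y))) ⟩
    blockDet (λ y t → restrictedRow o y (column w t)) (fibre (rowVertex k o) w) (allFin k) ∎
    where open import Relation.Binary.Reasoning.Setoid setoid

  restrictedRow-edge : ∀ o e w t → o e ≡ w → restrictedRow o (e F.↑ˡ k) (column w t) ≡ rigEntry x e w t
  restrictedRow-edge o e w t oe≡w = begin
    (if does (vertexOf (column w t) ≟ rowVertex k o (e F.↑ˡ k)) then MT x (e F.↑ˡ k) (column w t) else 0#)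
      ≡⟨ cong₂ (λ a b → if does (a ≟ b) then MT x (e F.↑ˡ k) (column w t) else 0#)
               (vertexOf-combine w t) (trans (rowVertex-↑ˡ k o e) oe≡w) ⟩
    (if does (w ≟ w) then MT x (e F.↑ˡ k) (column w t) else 0#)
      ≡⟨ cong (λ b → if b then MT x (e F.↑ˡ k) (column w t) else 0#) (dec-true (w ≟ w) refl) ⟩
    MT x (e F.↑ˡ k) (column w t)
      ≡⟨ MT-↑ˡ e (column w t) ⟩
    rigEntry x e (vertexOf (column w t)) (F.remainder {suc n} k (column w t))
      ≡⟨ cong₂ (rigEntry x e) (vertexOf-combine w t) (remainder-combine w t) ⟩
    rigEntry x e w t ∎
    where open ≡-Reasoning

  edgeBlock : ∀ o i →
    block o (suc i) ≈ det (submatrix k (λ e t → rigEntry x e (suc i) t) (fibre o (suc i)) (allFin k))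
  edgeBlock o i = begin
    block o w
      ≈⟨ block≈restrictedRows o w ⟩
    blockDet (λ y t → restrictedRow o y (column w t)) (fibre (rowVertex k o) w) (allFin k)
      ≡⟨ cong₂ (blockDet (λ y t → restrictedRow o y (column w t)))
               (trans (fibre-rowVertex k o w) (LP.++-identityʳ _)) (sym (LP.map-id (allFin k))) ⟩
    blockDet (λ y t → restrictedRow o y (column w t)) (map (F._↑ˡ k) (fibre o w)) (map id (allFin k))
      ≈⟨ ≈-sym (blockDet-map (λ y t → restrictedRow o y (column w t)) (F._↑ˡ k) id (fibre o w) (allFin k)) ⟩
    blockDet (λ e t → restrictedRow o (e F.↑ˡ k) (column w t)) (fibre o w) (allFin k)
      ≈⟨ blockDet-cong-rows (allFin k) (all-filter (λ e → o e ≟ w) (allFin m))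
           (λ e oe≡w t → ≈-reflexive (restrictedRow-edge o e w t oe≡w)) ⟩
    blockDet (λ e t → rigEntry x e w t) (fibre o w) (allFin k)
      ≡⟨ blockDet-allFin (λ e t → rigEntry x e w t) (fibre o w) ⟩
    det (submatrix k (λ e t → rigEntry x e w t) (fibre o w) (allFin k)) ∎
    where
    open import Relation.Binary.Reasoning.Setoid setoid
    w : Fin (suc n)
    w = suc i

  rigEntry-incident : ∀ e w t → w ≡ src H e ⊎ w ≡ tgt H e →
    rigEntry x e w t ≈ alt (orientation H e w) (vec x e t)
  rigEntry-incident e w t incident with w ≟ src H e | w ≟ tgt H e
  ... | yes _ | _     = ≈-refl
  ... | no _  | yes _ = ≈-refl
  ... | no w≢s | no w≢t = contradiction incident [ w≢s , w≢t ]′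

  rigEntry-nonincident : ∀ e w t → w ≢ src H e → w ≢ tgt H e → rigEntry x e w t ≡ 0#
  rigEntry-nonincident e w t w≢s w≢t with w ≟ src H e | w ≟ tgt H e
  ... | yes w≡s | _     = contradiction w≡s w≢s
  ... | no _    | yes w≡t = contradiction w≡t w≢t
  ... | no _    | no _  = refl

  rigEntry-red : ∀ e w t → red H e ≡ true → toℕ t ℕ.< k ℕ.∸ g → rigEntry x e w t ≈ 0#
  rigEntry-red e w t isRed t<k-g with w ≟ src H e | w ≟ tgt H e
  ... | yes _ | _     = vec≈0
    where
    vec≈0 : vec x e t ≈ 0#
    vec≈0 = redZero x e (Equivalence.from T-≡ isRed) t t<k-g
  ... | no _  | yes _ = ≈-trans (-‿cong (redZero x e (Equivalence.from T-≡ isRed) t t<k-g)) -0#≈0#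
  ... | no _  | no _  = ≈-refl

  fanBlock : ∀ o i → (∀ e → o e ≡ src H e ⊎ o e ≡ tgt H e) →
    block o (suc i) ≈ alt (orientationSum k H o (suc i)) (bracket x o (suc i))
  fanBlock o i incident = begin
    block o w
      ≈⟨ edgeBlock o i ⟩
    det (submatrix k (λ e t → rigEntry x e w t) (fibre o w) (allFin k))
      ≈⟨ det-cong (λ i t → ≈-trans (≈-reflexive (submatrix-allFin (λ e t → rigEntry x e w t) (fibre o w) i t))
                           (≈-trans (at-cong-All (all-filter (λ e → o e ≟ w) (allFin m))
                                       (λ e oe≡w → rigEntry-incident e w t
                                                     (subst (λ v → v ≡ src H e ⊎ v ≡ tgt H e) oe≡w (incident e)))
                                       (toℕ i))
                                    (at-alt (λ e → orientation H e w) (λ e → vec x e t) (fibre o w) (toℕ i)))) ⟩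
    det (λ i t → alt (at 0 (λ e → orientation H e w) (fibre o w) (toℕ i)) (at 0# (λ e → vec x e t) (fibre o w) (toℕ i)))
      ≈⟨ det-alt-rows (λ i → at 0 (λ e → orientation H e w) (fibre o w) (toℕ i))
                      (λ i t → at 0# (λ e → vec x e t) (fibre o w) (toℕ i)) ⟩
    alt (orientationSum k H o w) (det (λ i t → at 0# (λ e → vec x e t) (fibre o w) (toℕ i)))
      ≈⟨ alt-cong (orientationSum k H o w)
                  (det-cong (λ i t → ≈-reflexive (sym (rowsMatrix-at (vec x) (fibre o w) i t)))) ⟩
    alt (orientationSum k H o w) (bracket x o w) ∎
    where
    open import Relation.Binary.Reasoning.Setoid setoid
    w : Fin (suc n)
    w = suc i

  redBlock : ∀ o i → fibreSize o (suc i) ≡ k → g ℕ.< length (redEdgesOf H o (suc i)) → block o (suc i) ≈ 0#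
  redBlock o i size≡k overloaded =
    ≈-trans (edgeBlock o i) (det-zero-corner k _ isRed (k ℕ.∸ g) corner≈0 many)
    where
    w : Fin (suc n)
    w = suc i
    isRed : Fin k → Bool
    isRed i′ = at false (red H) (fibre o w) (toℕ i′)
    corner≈0 : ∀ i′ t → isRed i′ ≡ true → toℕ t ℕ.< k ℕ.∸ g →
               submatrix k (λ e t → rigEntry x e w t) (fibre o w) (allFin k) i′ t ≈ 0#
    corner≈0 i′ t red-i′ t<k-g =
      ≈-trans (≈-reflexive (submatrix-allFin (λ e t → rigEntry x e w t) (fibre o w) i′ t))
              (at-vanish (red H) (λ e → rigEntry x e w t) (fibre o w) (toℕ i′)
                         (λ e isRed → rigEntry-red e w t isRed t<k-g) red-i′)
    reds : count isRed ≡ length (redEdgesOf H o w)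
    reds = subst (λ K → count {K} (λ i′ → at false (red H) (fibre o w) (toℕ i′)) ≡ length (redEdgesOf H o w))
                 size≡k (count-at (red H) (fibre o w))
    many : k ℕ.∸ (k ℕ.∸ g) ℕ.< count isRed
    many = ℕP.≤-<-trans (m∸[m∸n]≤n k g) (subst (g ℕ.<_) (sym reds) overloaded)

  identityBlock : ∀ o → fibre o zero ≡ [] → block o zero ≈ 1#
  identityBlock o unowned₀ = begin
    block o zero
      ≈⟨ block≈restrictedRows o zero ⟩
    blockDet (λ y t → restrictedRow o y (column zero t)) (fibre (rowVertex k o) zero) (allFin k)
      ≡⟨ cong₂ (blockDet (λ y t → restrictedRow o y (column zero t)))
               (trans (fibre-rowVertex k o zero) (cong (λ l → map (F._↑ˡ k) l ++ map (m F.↑ʳ_) (allFin k)) unowned₀))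
               (sym (LP.map-id (allFin k))) ⟩
    blockDet (λ y t → restrictedRow o y (column zero t)) (map (m F.↑ʳ_) (allFin k)) (map id (allFin k))
      ≈⟨ ≈-sym (blockDet-map (λ y t → restrictedRow o y (column zero t)) (m F.↑ʳ_) id (allFin k) (allFin k)) ⟩
    blockDet (λ i t → restrictedRow o (m F.↑ʳ i) (column zero t)) (allFin k) (allFin k)
      ≡⟨ blockDet-allFin (λ i t → restrictedRow o (m F.↑ʳ i) (column zero t)) (allFin k) ⟩
    det (submatrix k (λ i t → restrictedRow o (m F.↑ʳ i) (column zero t)) (allFin k) (allFin k))
      ≈⟨ det-identity _ (λ i t → ≈-reflexive (trans (submatrix-allFin _ (allFin k) i t)
           (trans (at-tabulate 0# (λ i → restrictedRow o (m F.↑ʳ i) (column zero t)) id i)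
                  (restrictedRow-identity i t)))) ⟩
    1# ∎
    where
    open import Relation.Binary.Reasoning.Setoid setoid
    restrictedRow-identity : ∀ i t → restrictedRow o (m F.↑ʳ i) (column zero t) ≡ (if does (t ≟ i) then 1# else 0#)
    restrictedRow-identity i t = trans
      (cong₂ (λ a b → if does (a ≟ b) then MT x (m F.↑ʳ i) (column zero t) else 0#)
             (vertexOf-combine zero t) (rowVertex-↑ʳ k o i))
      (MT-↑ʳ-combine i t)

  nonincidentRow : ∀ o e → o e ≢ src H e → o e ≢ tgt H e → det (restricted o) ≈ 0#
  nonincidentRow o e oe≢s oe≢t = det-zero-row (edgeRow e) (λ c → ≈-reflexive
    (trans (cong (λ y → restrictedRow o y c) (cast-edgeRow e))
    (trans (cong (λ v → if does (vertexOf c ≟ v) then MT x (e F.↑ˡ k) c else 0#) (rowVertex-↑ˡ k o e)) (vanish c))))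
    where
    vanish : ∀ c → (if does (vertexOf c ≟ o e) then MT x (e F.↑ˡ k) c else 0#) ≡ 0#
    vanish c with vertexOf c ≟ o e
    ... | yes c∈ = trans (MT-↑ˡ e c) (rigEntry-nonincident e (vertexOf c) _ (λ eq → oe≢s (trans (sym c∈) eq))
                                                                            (λ eq → oe≢t (trans (sym c∈) eq)))
    ... | no _   = refl

  fibreSize-rowOwner : ∀ o w → fibreSize (rowOwner o) w ≡ fibreSize o w ℕ.+ (if does (zero ≟ w) then k else 0)
  fibreSize-rowOwner o w = trans (cong length (fibre-cast (sym sq) (rowVertex k o) w))
    (trans (LP.length-map (F.cast (sym sq)) (fibre (rowVertex k o) w)) (fibreSize-rowVertex k o w))

  matching⇒unowned₀ : ∀ o → Matching (rowOwner o) vertexOf → ∀ e → o e ≢ zero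
  matching⇒unowned₀ o match = fibreSize≡0 o zero (ℕP.+-cancelʳ-≡ k (fibreSize o zero) 0
    (trans (sym (fibreSize-rowOwner o zero)) (trans (match zero) (fibreSize-quotient k zero))))

  matching⇒size : ∀ o → Matching (rowOwner o) vertexOf → ∀ i → fibreSize o (suc i) ≡ k
  matching⇒size o match i = trans (sym (ℕP.+-identityʳ _))
    (trans (sym (fibreSize-rowOwner o (suc i))) (trans (match (suc i)) (fibreSize-quotient k (suc i))))

  fan⇒unowned₀ : ∀ o → IsFan k g H o → fibre o zero ≡ []
  fan⇒unowned₀ o (edges , _) =
    LP.filter-none (λ e → o e ≟ zero) (All.universal (λ e oe≡0 → proj₁ (edges e) (cong toℕ oe≡0)) (allFin m))

  fan⇒matching : ∀ o → IsFan k g H o → Matching (rowOwner o) vertexOf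
  fan⇒matching o fan@(_ , vertices) w =
    trans (fibreSize-rowOwner o w) (trans (sizes w) (sym (fibreSize-quotient k w)))
    where
    sizes : ∀ w → fibreSize o w ℕ.+ (if does (zero ≟ w) then k else 0) ≡ k
    sizes zero    = cong (λ l → length l ℕ.+ k) (fan⇒unowned₀ o fan)
    sizes (suc i) = trans (ℕP.+-identityʳ _) (proj₁ (vertices (suc i) (λ ())))

  exponent : (Fin m → Fin (suc n)) → ℕ
  exponent o = blockExponent (suc n ℕ.* k) (rowOwner o) (fibreSize vertexOf)

  det-restricted : ∀ o → Matching (rowOwner o) vertexOf →
    det (restricted o) ≈ alt (exponent o) (prodFin (suc n) (block o))
  det-restricted o =
    det-blockDiagonal (suc n ℕ.* k) (rowOwner o) vertexOf (restricted o) (quotient-monotone k) (supported o)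

  fanCase : ∀ o → IsFan k g H o → det (restricted o) ≈ sgn (fanSign k H sq o) * fanProduct x o
  fanCase o fan@(edges , _) = begin
    det (restricted o)
      ≈⟨ det-restricted o (fan⇒matching o fan) ⟩
    alt E (prodFin (suc n) (block o))
      ≈⟨ alt-cong E (prodFin-cong (suc n) blocks) ⟩
    alt E (prodFin (suc n) (λ w → alt (orientationSum k H o w) (factor w)))
      ≈⟨ alt-cong E (prodFin-alt (suc n) (orientationSum k H o) factor) ⟩
    alt E (alt (ℕΣ.sum (orientationSum k H o)) (fanProduct x o))
      ≡⟨ sym (alt-+ℕ E (ℕΣ.sum (orientationSum k H o)) (fanProduct x o)) ⟩
    alt (E ℕ.+ ℕΣ.sum (orientationSum k H o)) (fanProduct x o)
      ≈⟨ alt-sgn (E ℕ.+ ℕΣ.sum (orientationSum k H o)) (fanProduct x o) ⟩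
    sgn (fanSign k H sq o) * fanProduct x o ∎
    where
    open import Relation.Binary.Reasoning.Setoid setoid
    E : ℕ
    E = exponent o
    factor : Fin (suc n) → Carrier
    factor zero    = 1#
    factor (suc i) = bracket x o (suc i)
    orientation₀ : orientationSum k H o zero ≡ 0
    orientation₀ = trans (cong (λ l → ℕΣ.sum {k} (λ i → at 0 (λ e → orientation H e zero) l (toℕ i)))
                               (fan⇒unowned₀ o fan))
                         (∑-zero k (λ _ → refl))
    blocks : ∀ w → block o w ≈ alt (orientationSum k H o w) (factor w)
    blocks zero    = ≈-trans (identityBlock o (fan⇒unowned₀ o fan))
                             (≈-reflexive (cong (λ e → alt e 1#) (sym orientation₀)))
    blocks (suc i) = fanBlock o i (proj₂ ∘ edges)

  nonFanCase : ∀ o → ¬ IsFan k g H o → det (restricted o) ≈ 0#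
  nonFanCase o ¬fan with FP.all? (λ w → fibreSize (rowOwner o) w ℕ.≟ fibreSize vertexOf w)
  ... | no ¬match = det-blockMismatch _ (rowOwner o) vertexOf (restricted o) (quotient-monotone k) (supported o) ¬match
  ... | yes match with FP.all? (λ e → (o e ≟ src H e) ⊎-dec (o e ≟ tgt H e))
  ...   | no ¬incident with FP.¬∀⟶∃¬ m _ (λ e → (o e ≟ src H e) ⊎-dec (o e ≟ tgt H e)) ¬incident
  ...     | e , ¬incident-e = nonincidentRow o e (¬incident-e ∘ inj₁) (¬incident-e ∘ inj₂)
  nonFanCase o ¬fan | yes match | yes incident
    with FP.¬∀⟶∃¬ n _ (λ i → length (redEdgesOf H o (suc i)) ℕ.≤? g) (¬fan ∘ fan)
    where
    fan : (∀ i → length (redEdgesOf H o (suc i)) ≤ g) → IsFan k g H o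
    fan light = (λ e → (λ oe≡0 → matching⇒unowned₀ o match e (FP.toℕ-injective oe≡0)) , incident e) , vertices
      where
      vertices : ∀ w → toℕ w ≢ 0 → length (edgesOf o w) ≡ k × length (redEdgesOf H o w) ≤ g
      vertices zero    w≢0 = contradiction refl w≢0
      vertices (suc i) _   = matching⇒size o match i , light i
  ... | i , heavy = ≈-trans (det-restricted o match)
    (≈-trans (alt-cong (exponent o) (prodFin-zero (suc n) (block o) (suc i) heavyBlock)) (alt-0 (exponent o)))
    where
    heavyBlock : block o (suc i) ≈ 0#
    heavyBlock = redBlock o i (matching⇒size o match i) (ℕP.≰⇒> heavy)

  pureCondition≈fanSum : det M ≈ fanSum (fanSign k H sq) x
  pureCondition≈fanSum = ≈-trans det-M-expansion
    (sumList-filter (isFan? k g H) (allFuns m (suc n)) (λ o → det (restricted o))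
                    (λ o → sgn (fanSign k H sq o) * fanProduct x o) nonFanCase fanCase)

proposition3 : (k g n m : ℕ) → 1 ≤ k → 1 ≤ g → (n≥1 : 1 ≤ n) →
    (H : BiGraph n m) → (cnt : Counted k g H) →
    Σ[ σ ∈ ((Fin m → Fin n) → Bool) ]
      ((Rg : CommutativeRing 0ℓ 0ℓ) → (x : Frame.Frame Rg k g H) →
        CommutativeRing._≈_ Rg
          (Frame.pureCondition Rg x (counted⇒square n≥1 cnt))
          (Frame.fanSum Rg σ x))
proposition3 k g (suc n) m _ _ n≥1 H cnt =
  fanSign k H sq , λ Rg x → Expansion.pureCondition≈fanSum Rg sq x
  where
  sq : suc n ℕ.* k ≡ m ℕ.+ k
  sq = counted⇒square n≥1 cnt
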